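{- Let $n\ge1$ and $\alpha,\beta,\gamma\in\,]0,1]$. The map $\bar T:\Omega^0_n\times\{0,\dots,n\}\to\Omega^0_n\times\{0,\dots,n\}$, $\bar T(\omega,i)=(T(\omega,i),J(\omega,i))$, is a bijection satisfying $$\lambda(i)\,q(\omega)=\lambda(j)\,q(\omega')\qquad\text{for all }(\omega,i)\text{ with }(\omega',j)=\bar T(\omega,i),$$ where $\lambda(i)=\alpha$ for $1\le i\le n-1$, $\lambda(0)=\beta$, $\lambda(n)=\gamma$.
   Context: A complete configuration of length $n$ is a pair of rows (top, bottom) of $n$ cells, each containing a black ($\bullet$) or white ($\circ$) particle, such that the two rows together contain $n$ black and $n$ white particles and for every $j$ the first $j$ columns contain at least as many black as white particles; $\Omega^0_n$ is their set. Columns are numbered $1,\dots,n$, wall $i\in\{0,\dots,n\}$ between columns $i$ and $i+1$; $t_c,b_c$ are the top and bottom particles of column $c$. $T(\omega,i)$ and $J(\omega,i)$ are defined by cases (unmentioned particles keep their relative order in their row): (a') $1\le i\le n-1$, $t_i=\bullet$, $t_{i+1}=\circ$, $b_{i+1}=\bullet$: with $j_1$ the smallest $j\in\{0,\dots,i-1\}$ such that $t_{j+1},\dots,t_{i-1}$ are white, $T(\omega,i)$ is obtained by removing column $i+1$ and reinserting it as column $j_1+1$; $J=j_1$. (a'') $1\le i\le n-1$, $t_i=\bullet$, $t_{i+1}=\circ$, $b_{i+1}=\circ$: with $j_2$ the largest $j\in\{i+1,\dots,n\}$ such that $t_{i+2},\dots,t_j$ are black, delete $t_i$ and insert a black particle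 as top cell $j_2$; delete $b_{i+1}$ and insert a white particle as bottom cell $j_2+1$ if $j_2<n$, bottom cell $n$ if $j_2=n$; $J=j_2$. (b) $i=0$, $t_1=\circ$: with $j_2$ the largest $j\in\{1,\dots,n\}$ such that $t_2,\dots,t_j$ are black, delete column $1$, insert a black particle as top cell $j_2$ and a white particle as bottom cell $j_2+1$ if $j_2<n$, bottom cell $n$ if $j_2=n$; $J=j_2$. (c) $i=n$, $t_n=\bullet$: with $j_1$ the smallest $j\in\{0,\dots,n-1\}$ such that $t_{j+1},\dots,t_{n-1}$ are white, delete column $n$ and insert a column ($\circ$ on top, $\bullet$ below) as column $j_1+1$; $J=j_1$. (d) otherwise $T(\omega,i)=\omega$, $J=i$. Weights: concatenations of complete configurations are complete; a nonempty complete configuration is prime if not a concatenation of two nonempty ones. Each $\omega$ factors uniquely into primes: a column ($\bullet$ over $\circ$), a column ($\circ$ over $\bullet$), or a block consisting of a column with two black particles, a complete configuration $\omega'$ (the inside), and a column with two white particles. Bottom-row labels: each white bottom particle not in a block gets label $z$; then each black bottom particle not in the inside of a block and with no $z$-label to its left gets label $y$. With $n_y,n_z$ the label counts, $q(\omega)=\alpha^{n_y+n_z}\beta^{\,n-n_y}\gamma^{\,n-n_z}$. -}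

module Defs where

open import Data.Bool using (Bool; true; false; if_then_else_; not; _∧_)
open import Data.Nat using (ℕ; zero; suc; _+_; _∸_; _≤_; _≡ᵇ_; _<ᵇ_)
open import Data.List using (List; []; _∷_; [_]; length; take; zip)
open import Data.Product using (_×_; _,_; proj₁; proj₂)
open import Relation.Binary.PropositionalEquality using (_≡_)
open import Algebra.Bundles using (CommutativeSemiring)

-- Configurations.  A cell holds a black particle (true) or a white one
-- (false).  A configuration is the pair (top row, bottom row).

Config : Set
Config = List Bool × List Bool

blacks : List Bool → ℕ
blacks [] = 0
blacks (true ∷ xs) = suc (blacks xs)
blacks (false ∷ xs) = blacks xs

whites : List Bool → ℕ
whites [] = 0
whites (true ∷ xs) = whites xs
whites (false ∷ xs) = suc (whites xs)

Complete : ℕ → Config → Set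
Complete n (t , b) =
  length t ≡ n × length b ≡ n ×
  blacks t + blacks b ≡ n × whites t + whites b ≡ n ×
  (∀ j → j ≤ n →
     whites (take j t) + whites (take j b) ≤ blacks (take j t) + blacks (take j b))

at0 : List Bool → ℕ → Bool
at0 [] _ = false
at0 (x ∷ xs) zero = x
at0 (x ∷ xs) (suc k) = at0 xs k

-- cell c of a row, columns numbered 1..n
cell : List Bool → ℕ → Bool
cell xs c = at0 xs (c ∸ 1)

removeAt : {A : Set} → ℕ → List A → List A
removeAt _ [] = []
removeAt zero (x ∷ xs) = xs
removeAt (suc k) (x ∷ xs) = x ∷ removeAt k xs

insertAt : {A : Set} → ℕ → A → List A → List A
insertAt zero a xs = a ∷ xs
insertAt (suc k) a [] = [ a ]
insertAt (suc k) a (x ∷ xs) = x ∷ insertAt k a xs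

scanL : List Bool → ℕ → ℕ
scanL t zero = 0
scanL t (suc k) = if cell t (suc k) then suc k else scanL t k

scanR : List Bool → ℕ → ℕ → ℕ
scanR t zero k = k
scanR t (suc f) k = if cell t (suc k) then scanR t f (suc k) else k

-- position (1-based) of the inserted white bottom particle:
-- j₂+1 if j₂ < n, and n if j₂ = n
wpos : ℕ → ℕ → ℕ
wpos n j₂ = if j₂ <ᵇ n then suc j₂ else n

caseA' : ℕ → Config → ℕ → Config × ℕ
caseA' n (t , b) i =
  let j₁ = scanL t (i ∸ 1) in
  (insertAt j₁ (cell t (suc i)) (removeAt i t) ,
   insertAt j₁ (cell b (suc i)) (removeAt i b)) , j₁

caseA'' : ℕ → Config → ℕ → Config × ℕ
caseA'' n (t , b) i =
  let j₂ = scanR t (n ∸ suc i) (suc i) in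
  (insertAt (j₂ ∸ 1) true (removeAt (i ∸ 1) t) ,
   insertAt (wpos n j₂ ∸ 1) false (removeAt i b)) , j₂

caseB : ℕ → Config → Config × ℕ
caseB n (t , b) =
  let j₂ = scanR t (n ∸ 1) 1 in
  (insertAt (j₂ ∸ 1) true (removeAt 0 t) ,
   insertAt (wpos n j₂ ∸ 1) false (removeAt 0 b)) , j₂

caseC : ℕ → Config → Config × ℕ
caseC n (t , b) =
  let j₁ = scanL t (n ∸ 1) in
  (insertAt j₁ false (removeAt (n ∸ 1) t) ,
   insertAt j₁ true (removeAt (n ∸ 1) b)) , j₁

Tbar : ℕ → Config → ℕ → Config × ℕ
Tbar n (t , b) i =
  if i ≡ᵇ 0 then
    (if not (cell t 1) then caseB n (t , b) else ((t , b) , i))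
  else if i ≡ᵇ n then
    (if cell t n then caseC n (t , b) else ((t , b) , i))
  else if cell t i ∧ not (cell t (suc i)) then
    (if cell b (suc i) then caseA' n (t , b) i else caseA'' n (t , b) i)
  else ((t , b) , i)

-- The prime factorisation is read off the column list from the
-- left: at height 0 (height = #black − #white so far), a column (•,∘) or
-- (∘,•) is a prime by itself, and a column (•,•) opens a block which
-- extends up to the first column bringing the height back to 0 (that
-- closing column is (∘,∘)); columns strictly between are the inside.
-- z-label: white bottom particle not in a block = column (•,∘) at height 0.
-- y-label: black bottom particle not in an inside = column (∘,•) at
-- height 0 or an opening column (•,•), with no z-label to its left.
-- labels cols h seenZ = (n_y , n_z) for the remaining columns.

labels : List (Bool × Bool) → ℕ → Bool → ℕ × ℕ
labels [] h z = 0 , 0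
labels ((tc , bc) ∷ cs) (suc h) z with tc | bc
... | true  | true  = labels cs (suc (suc (suc h))) z
... | false | false = labels cs (h ∸ 1) z
... | _     | _     = labels cs (suc h) z
labels ((true , false) ∷ cs) zero z =
  let r = labels cs zero true in proj₁ r , suc (proj₂ r)
labels ((false , true) ∷ cs) zero z =
  let r = labels cs zero z in (if z then proj₁ r else suc (proj₁ r)) , proj₂ r
labels ((true , true) ∷ cs) zero z =
  let r = labels cs 2 z in (if z then proj₁ r else suc (proj₁ r)) , proj₂ r
labels ((false , false) ∷ cs) zero z = labels cs zero z

ny : Config → ℕ
ny (t , b) = proj₁ (labels (zip t b) 0 false)

nz : Config → ℕ
nz (t , b) = proj₂ (labels (zip t b) 0 false)

module Weights {c ℓ} (R : CommutativeSemiring c ℓ) where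
  open CommutativeSemiring R using (Carrier; _*_; 1#)

  pow : Carrier → ℕ → Carrier
  pow x zero = 1#
  pow x (suc k) = x * pow x k

  q : ℕ → Carrier → Carrier → Carrier → Config → Carrier
  q n α β γ ω = pow α (ny ω + nz ω) * pow β (n ∸ ny ω) * pow γ (n ∸ nz ω)

  lam : ℕ → Carrier → Carrier → Carrier → ℕ → Carrier
  lam n α β γ i = if i ≡ᵇ 0 then β else if i ≡ᵇ n then γ else α

{-# OPTIONS --safe #-}
-- Read a configuration as its list of columns and follow the height, the
-- number of • minus the number of ∘ read so far: (•,•) raises it by 2,
-- (∘,∘) lowers it by 2 and the two mixed columns keep it. Completeness says
-- exactly that this height path runs from 0 to 0 without going below 0.
-- Every nontrivial case of T̄ is composed of two kinds of path-preserving
-- edits: inserting or deleting a flat column, and replacing a peak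
-- (•,x)(∘,∘) by the column (∘,x) or back. Hence T̄ preserves completeness.
-- Each case is undone by an explicit map T̄⁻¹ scanning in the opposite
-- direction, which gives injectivity; recognising the shape of ω′ around
-- column j exhibits a preimage of every (ω′ , j), which gives surjectivity.
-- The labels change only at the edited columns, and the change of (n_y , n_z)
-- exactly compensates the change from λ(i) to λ(j). Comparing exponents of
-- α, β, γ then gives the weight identity in every commutative semiring.
module Submission where

open import Defs
open import Data.Bool using (Bool; true; false; if_then_else_; not; _∧_)
open import Data.Nat using (ℕ; zero; suc; _+_; _∸_; _≤_; _<_; z≤n; s≤s; _≡ᵇ_; _<ᵇ_)
open import Data.Nat.Properties
open import Data.Nat.Tactic.RingSolver using (solve-∀)
open import Algebra.Properties.CommutativeSemigroup +-commutativeSemigroup using (interchange)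
open import Data.List using (List; []; _∷_; [_]; length; take; zip; map; _++_; replicate)
open import Data.List.Properties using (map-++; length-map; length-++; ++-assoc; length-replicate; ++-identityʳ)
open import Data.Product using (_×_; _,_; Σ; proj₁; proj₂; Σ-syntax)
open import Data.Sum using (inj₁; inj₂)
open import Data.Empty using (⊥; ⊥-elim)
open import Relation.Binary.PropositionalEquality hiding ([_])
open import Algebra.Bundles using (CommutativeSemiring)
import Algebra.Solver.CommutativeMonoid as CommutativeMonoidSolver
open ≡-Reasoning

if-true : ∀ {a} {A : Set a} {c : Bool} {x y : A} → c ≡ true → (if c then x else y) ≡ x
if-true refl = refl

if-false : ∀ {a} {A : Set a} {c : Bool} {x y : A} → c ≡ false → (if c then x else y) ≡ y
if-false refl = refl

≡ᵇ-refl : ∀ n → (n ≡ᵇ n) ≡ true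
≡ᵇ-refl zero    = refl
≡ᵇ-refl (suc n) = ≡ᵇ-refl n

<⇒≡ᵇ≡false : ∀ {m n} → m < n → (m ≡ᵇ n) ≡ false
<⇒≡ᵇ≡false {zero}  {suc n} _       = refl
<⇒≡ᵇ≡false {suc m} {suc n} (s≤s p) = <⇒≡ᵇ≡false p

<⇒<ᵇ≡true : ∀ {m n} → m < n → (m <ᵇ n) ≡ true
<⇒<ᵇ≡true {zero}  {suc n} _       = refl
<⇒<ᵇ≡true {suc m} {suc n} (s≤s p) = <⇒<ᵇ≡true p

<ᵇ-irrefl : ∀ n → (n <ᵇ n) ≡ false
<ᵇ-irrefl zero    = refl
<ᵇ-irrefl (suc n) = <ᵇ-irrefl n

wpos-< : ∀ {n j} → j < n → wpos n j ≡ suc j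
wpos-< p rewrite <⇒<ᵇ≡true p = refl

wpos-n : ∀ n → wpos n n ≡ n
wpos-n n rewrite <ᵇ-irrefl n = refl

module _ {A : Set} where

  removeAt-++ : ∀ (xs : List A) {ys} d {k} → k ≡ length xs + d →
                removeAt k (xs ++ ys) ≡ xs ++ removeAt d ys
  removeAt-++ []       d refl = refl
  removeAt-++ (x ∷ xs) d refl = cong (x ∷_) (removeAt-++ xs d refl)

  insertAt-++ : ∀ (xs : List A) {ys} d a {k} → k ≡ length xs + d →
                insertAt k a (xs ++ ys) ≡ xs ++ insertAt d a ys
  insertAt-++ []       d a refl = refl
  insertAt-++ (x ∷ xs) d a refl = cong (x ∷_) (insertAt-++ xs d a refl)

  assoc-snoc : ∀ (P Q : List A) c R → P ++ Q ++ c ∷ R ≡ ((P ++ Q) ++ [ c ]) ++ R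
  assoc-snoc P Q c R = sym (trans (++-assoc (P ++ Q) [ c ] R) (++-assoc P Q (c ∷ R)))

  replicate-++-∷ : ∀ k (a : A) zs → replicate k a ++ a ∷ zs ≡ a ∷ replicate k a ++ zs
  replicate-++-∷ zero    a zs = refl
  replicate-++-∷ (suc k) a zs = cong (a ∷_) (replicate-++-∷ k a zs)

  removeAt-++-++ : ∀ (xs ys : List A) {zs} d {k} → k ≡ length xs + (length ys + d) →
                   removeAt k (xs ++ ys ++ zs) ≡ xs ++ ys ++ removeAt d zs
  removeAt-++-++ xs ys d e = trans (removeAt-++ xs (length ys + d) e) (cong (xs ++_) (removeAt-++ ys d refl))

  insertAt-++-++ : ∀ (xs ys : List A) {zs} d a {k} → k ≡ length xs + (length ys + d) →
                   insertAt k a (xs ++ ys ++ zs) ≡ xs ++ ys ++ insertAt d a zs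
  insertAt-++-++ xs ys d a e = trans (insertAt-++ xs (length ys + d) a e) (cong (xs ++_) (insertAt-++ ys d a refl))

at0-++ : ∀ xs {ys} d {k} → k ≡ length xs + d → at0 (xs ++ ys) k ≡ at0 ys d
at0-++ []       d refl = refl
at0-++ (x ∷ xs) d refl = at0-++ xs d refl

at0-++-++ : ∀ xs ys {zs} d {k} → k ≡ length xs + (length ys + d) → at0 (xs ++ ys ++ zs) k ≡ at0 zs d
at0-++-++ xs ys d e = trans (at0-++ xs (length ys + d) e) (at0-++ ys d refl)

at0-replicate-++ : ∀ w a {ys} d → d < w → at0 (replicate w a ++ ys) d ≡ a
at0-replicate-++ (suc w) a zero    _       = refl
at0-replicate-++ (suc w) a (suc d) (s≤s p) = at0-replicate-++ w a d p

Col : Set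
Col = Bool × Bool

tops bots : List Col → List Bool
tops = map proj₁
bots = map proj₂

cols : List Col → Config
cols cs = tops cs , bots cs

run : Bool → List Bool → List Col
run a = map (a ,_)

tops-++ : ∀ xs ys → tops (xs ++ ys) ≡ tops xs ++ tops ys
tops-++ = map-++ proj₁

bots-++ : ∀ xs ys → bots (xs ++ ys) ≡ bots xs ++ bots ys
bots-++ = map-++ proj₂

length-tops : ∀ cs → length (tops cs) ≡ length cs
length-tops = length-map proj₁

length-bots : ∀ cs → length (bots cs) ≡ length cs
length-bots = length-map proj₂

length-run : ∀ a ws → length (run a ws) ≡ length ws
length-run a = length-map (a ,_)

tops-run : ∀ a ws → tops (run a ws) ≡ replicate (length ws) a
tops-run a []       = refl
tops-run a (w ∷ ws) = cong (a ∷_) (tops-run a ws)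

bots-run : ∀ a ws → bots (run a ws) ≡ ws
bots-run a []       = refl
bots-run a (w ∷ ws) = cong (w ∷_) (bots-run a ws)

tops-offset : ∀ P {k} d → k ≡ length P + d → k ≡ length (tops P) + d
tops-offset P d e = trans e (cong (_+ d) (sym (length-tops P)))

bots-offset : ∀ P {k} d → k ≡ length P + d → k ≡ length (bots P) + d
bots-offset P d e = trans e (cong (_+ d) (sym (length-bots P)))

cols-shape : ∀ P cs₁ a ws cs₂ →
             cols (P ++ cs₁ ++ run a ws ++ cs₂) ≡
             (tops P ++ tops cs₁ ++ replicate (length ws) a ++ tops cs₂ , bots P ++ bots cs₁ ++ ws ++ bots cs₂)
cols-shape P cs₁ a ws cs₂ = cong₂ _,_
  (trans (tops-++ P _) (cong (tops P ++_) (trans (tops-++ cs₁ _)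
    (cong (tops cs₁ ++_) (trans (tops-++ (run a ws) cs₂) (cong (_++ tops cs₂) (tops-run a ws)))))))
  (trans (bots-++ P _) (cong (bots P ++_) (trans (bots-++ cs₁ _)
    (cong (bots cs₁ ++_) (trans (bots-++ (run a ws) cs₂) (cong (_++ bots cs₂) (bots-run a ws)))))))

cols-shape-end : ∀ P cs₁ a ws →
                 cols (P ++ cs₁ ++ run a ws) ≡
                 (tops P ++ tops cs₁ ++ replicate (length ws) a ++ [] , bots P ++ bots cs₁ ++ ws ++ [])
cols-shape-end P cs₁ a ws =
  trans (cong (λ cs → cols (P ++ cs₁ ++ cs)) (sym (++-identityʳ (run a ws)))) (cols-shape P cs₁ a ws [])

length-shape : ∀ P cs₁ a ws cs₂ →
               length (P ++ cs₁ ++ run a ws ++ cs₂) ≡ length P + (length cs₁ + (length ws + length cs₂))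
length-shape P cs₁ a ws cs₂ =
  trans (length-++ P) (cong (length P +_) (trans (length-++ cs₁)
    (cong (length cs₁ +_) (trans (length-++ (run a ws)) (cong (_+ length cs₂) (length-run a ws))))))

split-last : ∀ (cs : List Col) → 0 < length cs → Σ[ L ∈ List Col ] Σ[ c ∈ Col ] cs ≡ L ++ [ c ]
split-last (c ∷ [])     _ = [] , c , refl
split-last (c ∷ d ∷ cs) _ with split-last (d ∷ cs) (s≤s z≤n)
... | L , c′ , e = c ∷ L , c′ , cong (c ∷_) e

split-at : ∀ (cs : List Col) k → suc k < length cs →
           Σ[ L ∈ List Col ] Σ[ c₁ ∈ Col ] Σ[ c₂ ∈ Col ] Σ[ R ∈ List Col ]
             cs ≡ L ++ c₁ ∷ c₂ ∷ R × length L ≡ k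
split-at (c₁ ∷ c₂ ∷ R) zero    _       = [] , c₁ , c₂ , R , refl , refl
split-at (c ∷ cs)      (suc k) (s≤s p) with split-at cs k p
... | L , c₁ , c₂ , R , e , l = c ∷ L , c₁ , c₂ , R , cong (c ∷_) e , cong suc l

at0-tops-at : ∀ L c R {k} → length L ≡ k → at0 (tops (L ++ c ∷ R)) k ≡ proj₁ c
at0-tops-at L c R refl =
  trans (cong (λ t → at0 t (length L)) (tops-++ L _)) (at0-++ (tops L) 0 (tops-offset L 0 (sym (+-identityʳ _))))

at0-tops-after : ∀ L c₁ c₂ R {k} → length L ≡ k → at0 (tops (L ++ c₁ ∷ c₂ ∷ R)) (suc k) ≡ proj₁ c₂
at0-tops-after L c₁ c₂ R refl =
  trans (cong (λ t → at0 t (suc (length L))) (tops-++ L _)) (at0-++ (tops L) 1 (tops-offset L 1 (+-comm 1 _)))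

length-++-run : ∀ P a ws → length (P ++ run a ws) ≡ length P + length ws
length-++-run P a ws = trans (length-++ P) (cong (length P +_) (length-run a ws))

length-snoc : ∀ (L : List Col) c → length (L ++ [ c ]) ≡ suc (length L)
length-snoc L c = trans (length-++ L) (+-comm _ 1)

++-snoc-assoc : ∀ (P Q R : List Col) c → ((P ++ [ c ]) ++ Q) ++ R ≡ P ++ c ∷ Q ++ R
++-snoc-assoc P Q R c = trans (++-assoc (P ++ [ c ]) Q R) (++-assoc P [ c ] (Q ++ R))

zip-tops-bots : ∀ cs → zip (tops cs) (bots cs) ≡ cs
zip-tops-bots []       = refl
zip-tops-bots (c ∷ cs) = cong (c ∷_) (zip-tops-bots cs)

cols-zip : ∀ (t b : List Bool) → length t ≡ length b → cols (zip t b) ≡ (t , b)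
cols-zip []      []      _ = refl
cols-zip (x ∷ t) (y ∷ b) e = cong₂ _,_ (cong (x ∷_) (cong proj₁ ih)) (cong (y ∷_) (cong proj₂ ih))
  where
  ih : cols (zip t b) ≡ (t , b)
  ih = cols-zip t b (suc-injective e)

length-zip : ∀ (t b : List Bool) → length t ≡ length b → length (zip t b) ≡ length t
length-zip []      []      _ = refl
length-zip (x ∷ t) (y ∷ b) e = cong suc (length-zip t b (suc-injective e))

-- Height paths

-- Path h cs h′: reading the columns cs from height h (number of black
-- minus number of white particles so far) ends at height h′; heights are
-- natural numbers, so the path never goes below 0.
data Path : ℕ → List Col → ℕ → Set where
  done   : ∀ {h} → Path h [] h
  up     : ∀ {h h′ cs} → Path (2 + h) cs h′ → Path h ((true , true) ∷ cs) h′
  down   : ∀ {h h′ cs} → Path h cs h′ → Path (2 + h) ((false , false) ∷ cs) h′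
  flat•∘ : ∀ {h h′ cs} → Path h cs h′ → Path h ((true , false) ∷ cs) h′
  flat∘• : ∀ {h h′ cs} → Path h cs h′ → Path h ((false , true) ∷ cs) h′

Path-resp : ∀ {h h′ xs ys} → xs ≡ ys → Path h xs h′ → Path h ys h′
Path-resp refl p = p

Path-++ : ∀ {h m h′ xs ys} → Path h xs m → Path m ys h′ → Path h (xs ++ ys) h′
Path-++ done       q = q
Path-++ (up p)     q = up (Path-++ p q)
Path-++ (down p)   q = down (Path-++ p q)
Path-++ (flat•∘ p) q = flat•∘ (Path-++ p q)
Path-++ (flat∘• p) q = flat∘• (Path-++ p q)

Path-split : ∀ {h h′} xs {ys} → Path h (xs ++ ys) h′ → Σ[ m ∈ ℕ ] Path h xs m × Path m ys h′
Path-split []                     p          = _ , done , p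
Path-split ((true , true) ∷ xs)   (up p)     with Path-split xs p
... | m , p₁ , p₂ = m , up p₁ , p₂
Path-split ((false , false) ∷ xs) (down p)   with Path-split xs p
... | m , p₁ , p₂ = m , down p₁ , p₂
Path-split ((true , false) ∷ xs)  (flat•∘ p) with Path-split xs p
... | m , p₁ , p₂ = m , flat•∘ p₁ , p₂
Path-split ((false , true) ∷ xs)  (flat∘• p) with Path-split xs p
... | m , p₁ , p₂ = m , flat∘• p₁ , p₂

insertFlat : ∀ {h h′} xs {ys} b → Path h (xs ++ ys) h′ → Path h (xs ++ (b , not b) ∷ ys) h′
insertFlat xs b p with Path-split xs p
insertFlat xs true  p | _ , p₁ , p₂ = Path-++ p₁ (flat•∘ p₂)
insertFlat xs false p | _ , p₁ , p₂ = Path-++ p₁ (flat∘• p₂)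

removeFlat : ∀ {h h′} xs {ys} b → Path h (xs ++ (b , not b) ∷ ys) h′ → Path h (xs ++ ys) h′
removeFlat xs b p with Path-split xs p
removeFlat xs true  p | _ , p₁ , flat•∘ p₂ = Path-++ p₁ p₂
removeFlat xs false p | _ , p₁ , flat∘• p₂ = Path-++ p₁ p₂

peak⇒flat : ∀ {h h′} xs x {ys} →
            Path h (xs ++ (true , x) ∷ (false , false) ∷ ys) h′ → Path h (xs ++ (false , x) ∷ ys) h′
peak⇒flat xs x p with Path-split xs p
peak⇒flat xs true  p | _ , p₁ , up (down p₂)     = Path-++ p₁ (flat∘• p₂)
peak⇒flat xs false p | _ , p₁ , flat•∘ (down p₂) = Path-++ p₁ (down p₂)

flat⇒peak : ∀ {h h′} xs x {ys} →
            Path h (xs ++ (false , x) ∷ ys) h′ → Path h (xs ++ (true , x) ∷ (false , false) ∷ ys) h′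
flat⇒peak xs x p with Path-split xs p
flat⇒peak xs true  p | _ , p₁ , flat∘• p₂ = Path-++ p₁ (up (down p₂))
flat⇒peak xs false p | _ , p₁ , down p₂   = Path-++ p₁ (flat•∘ (down p₂))

¬Path-up-last : ∀ {h} xs → Path h (xs ++ [ (true , true) ]) 0 → ⊥
¬Path-up-last xs p with Path-split xs p
... | _ , _ , up ()

-- Complete configurations as paths

whitesUpTo blacksUpTo : List Col → ℕ → ℕ
whitesUpTo cs j = whites (take j (tops cs)) + whites (take j (bots cs))
blacksUpTo cs j = blacks (take j (tops cs)) + blacks (take j (bots cs))

whitesIn blacksIn : List Col → ℕ
whitesIn cs = whites (tops cs) + whites (bots cs)
blacksIn cs = blacks (tops cs) + blacks (bots cs)

private
  module Counts (cs : List Col) where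
    wt wb bt bb : ℕ → ℕ
    wt j = whites (take j (tops cs))
    wb j = whites (take j (bots cs))
    bt j = blacks (take j (tops cs))
    bb j = blacks (take j (bots cs))
    wt′ wb′ bt′ bb′ : ℕ
    wt′ = whites (tops cs)
    wb′ = whites (bots cs)
    bt′ = blacks (tops cs)
    bb′ = blacks (bots cs)

  +-suc-suc : ∀ a b → suc a + suc b ≡ 2 + (a + b)
  +-suc-suc = solve-∀

  h+[1+a+1+b] : ∀ h a b → h + (suc a + suc b) ≡ 2 + h + (a + b)
  h+[1+a+1+b] = solve-∀

  h+[1+a+b] : ∀ h a b → h + (suc a + b) ≡ suc (h + (a + b))
  h+[1+a+b] = solve-∀

  h+[a+1+b] : ∀ h a b → h + (a + suc b) ≡ suc (h + (a + b))
  h+[a+1+b] = solve-∀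

Path⇒prefixes : ∀ {h h′ cs} → Path h cs h′ → ∀ j → whitesUpTo cs j ≤ h + blacksUpTo cs j
Path⇒prefixes p zero = z≤n
Path⇒prefixes done (suc j) = z≤n
Path⇒prefixes {h} {cs = _ ∷ cs} (up p) (suc j) =
  subst (whitesUpTo cs j ≤_) (sym (h+[1+a+1+b] h (bt j) (bb j))) (Path⇒prefixes p j)
  where open Counts cs
Path⇒prefixes {cs = _ ∷ cs} (down {h} p) (suc j) =
  subst (_≤ 2 + h + blacksUpTo cs j) (sym (+-suc-suc (wt j) (wb j))) (s≤s (s≤s (Path⇒prefixes p j)))
  where open Counts cs
Path⇒prefixes {h} {cs = _ ∷ cs} (flat•∘ p) (suc j) =
  subst₂ _≤_ (sym (+-suc (wt j) (wb j))) (sym (h+[1+a+b] h (bt j) (bb j))) (s≤s (Path⇒prefixes p j))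
  where open Counts cs
Path⇒prefixes {h} {cs = _ ∷ cs} (flat∘• p) (suc j) =
  subst (whitesUpTo ((false , true) ∷ cs) (suc j) ≤_) (sym (h+[a+1+b] h (bt j) (bb j))) (s≤s (Path⇒prefixes p j))
  where open Counts cs

Path⇒balance : ∀ {h h′ cs} → Path h cs h′ → h + blacksIn cs ≡ h′ + whitesIn cs
Path⇒balance done = refl
Path⇒balance {h} {cs = _ ∷ cs} (up p) = trans (h+[1+a+1+b] h bt′ bb′) (Path⇒balance p)
  where open Counts cs
Path⇒balance {cs = _ ∷ cs} (down {h′ = h′} p) =
  trans (cong (2 +_) (Path⇒balance p)) (sym (h+[1+a+1+b] h′ wt′ wb′))
  where open Counts cs
Path⇒balance {h} {cs = _ ∷ cs} (flat•∘ {h′ = h′} p) =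
  trans (h+[1+a+b] h bt′ bb′) (trans (cong suc (Path⇒balance p)) (sym (h+[a+1+b] h′ wt′ wb′)))
  where open Counts cs
Path⇒balance {h} {cs = _ ∷ cs} (flat∘• {h′ = h′} p) =
  trans (h+[a+1+b] h bt′ bb′) (trans (cong suc (Path⇒balance p)) (sym (h+[1+a+b] h′ wt′ wb′)))
  where open Counts cs

prefixes⇒Path : ∀ h cs → (∀ j → j ≤ length cs → whitesUpTo cs j ≤ h + blacksUpTo cs j) →
                whitesIn cs ≡ h + blacksIn cs → Path h cs 0
prefixes⇒Path h [] _ balance = subst (λ k → Path k [] 0) (trans balance (+-identityʳ h)) done
prefixes⇒Path h ((true , true) ∷ cs) prefixes balance =
  up (prefixes⇒Path (2 + h) cs
       (λ j j≤ → subst (whitesUpTo cs j ≤_) (h+[1+a+1+b] h (bt j) (bb j)) (prefixes (suc j) (s≤s j≤)))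
       (trans balance (h+[1+a+1+b] h bt′ bb′)))
  where open Counts cs
prefixes⇒Path zero ((false , false) ∷ cs) prefixes _ with prefixes 1 (s≤s z≤n)
... | ()
prefixes⇒Path (suc zero) ((false , false) ∷ cs) prefixes _ with prefixes 1 (s≤s z≤n)
... | s≤s ()
prefixes⇒Path (suc (suc h)) ((false , false) ∷ cs) prefixes balance =
  down (prefixes⇒Path h cs
         (λ j j≤ → ≤-pred (≤-pred (subst (_≤ 2 + h + blacksUpTo cs j) (+-suc-suc (wt j) (wb j))
                                          (prefixes (suc j) (s≤s j≤)))))
         (suc-injective (suc-injective (trans (sym (+-suc-suc wt′ wb′)) balance))))
  where open Counts cs
prefixes⇒Path h ((true , false) ∷ cs) prefixes balance =
  flat•∘ (prefixes⇒Path h cs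
           (λ j j≤ → ≤-pred (subst₂ _≤_ (+-suc (wt j) (wb j)) (h+[1+a+b] h (bt j) (bb j))
                                     (prefixes (suc j) (s≤s j≤))))
           (suc-injective (trans (sym (+-suc wt′ wb′)) (trans balance (h+[1+a+b] h bt′ bb′)))))
  where open Counts cs
prefixes⇒Path h ((false , true) ∷ cs) prefixes balance =
  flat∘• (prefixes⇒Path h cs
           (λ j j≤ → ≤-pred (subst (suc (whitesUpTo cs j) ≤_) (h+[a+1+b] h (bt j) (bb j))
                                    (prefixes (suc j) (s≤s j≤))))
           (suc-injective (trans balance (h+[a+1+b] h bt′ bb′))))
  where open Counts cs

blacks+whites≡length : ∀ xs → blacks xs + whites xs ≡ length xs
blacks+whites≡length []          = refl
blacks+whites≡length (true ∷ xs)  = cong suc (blacks+whites≡length xs)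
blacks+whites≡length (false ∷ xs) = trans (+-suc _ _) (cong suc (blacks+whites≡length xs))

m+m≡n+n⇒m≡n : ∀ m n → m + m ≡ n + n → m ≡ n
m+m≡n+n⇒m≡n zero    zero    _ = refl
m+m≡n+n⇒m≡n (suc m) (suc n) e =
  cong suc (m+m≡n+n⇒m≡n m n (suc-injective (trans (sym (+-suc m m)) (trans (suc-injective e) (+-suc n n)))))

Path⇒Complete : ∀ n cs → length cs ≡ n → Path 0 cs 0 → Complete n (cols cs)
Path⇒Complete n cs len p =
  trans (length-tops cs) len , trans (length-bots cs) len , blacks≡n ,
  trans (sym balanced) blacks≡n , λ j _ → Path⇒prefixes p j
  where
  balanced : blacksIn cs ≡ whitesIn cs
  balanced = Path⇒balance p
  particles : blacksIn cs + whitesIn cs ≡ n + n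
  particles = begin
    blacksIn cs + whitesIn cs
      ≡⟨ interchange (blacks (tops cs)) (blacks (bots cs)) (whites (tops cs)) (whites (bots cs)) ⟩
    (blacks (tops cs) + whites (tops cs)) + (blacks (bots cs) + whites (bots cs))
      ≡⟨ cong₂ _+_ (trans (blacks+whites≡length (tops cs)) (length-tops cs))
                   (trans (blacks+whites≡length (bots cs)) (length-bots cs)) ⟩
    length cs + length cs
      ≡⟨ cong₂ _+_ len len ⟩
    n + n ∎
  blacks≡n : blacksIn cs ≡ n
  blacks≡n = m+m≡n+n⇒m≡n _ _ (trans (cong (blacksIn cs +_) balanced) particles)

Complete⇒Path : ∀ n t b → Complete n (t , b) →
                Σ[ cs ∈ List Col ] (t , b) ≡ cols cs × length cs ≡ n × Path 0 cs 0
Complete⇒Path n t b (len-t , len-b , blacks≡n , whites≡n , prefixes) =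
  zip t b , sym cols≡ , trans (length-zip t b t≡b) len-t ,
  prefixes⇒Path 0 (zip t b)
    (λ j j≤ → subst (λ (t′ , b′) → whites (take j t′) + whites (take j b′)
                                     ≤ blacks (take j t′) + blacks (take j b′))
                    (sym cols≡) (prefixes j (subst (j ≤_) (trans (length-zip t b t≡b) len-t) j≤)))
    (subst (λ (t′ , b′) → whites t′ + whites b′ ≡ blacks t′ + blacks b′) (sym cols≡)
           (trans whites≡n (sym blacks≡n)))
  where
  t≡b : length t ≡ length b
  t≡b = trans len-t (sym len-b)
  cols≡ : cols (zip t b) ≡ (t , b)
  cols≡ = cols-zip t b t≡b

-- Labels

infixl 6 _⊕_
_⊕_ : ℕ × ℕ → ℕ × ℕ → ℕ × ℕ
(y , z) ⊕ (y′ , z′) = y + y′ , z + z′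

⊕-assoc : ∀ a b c → (a ⊕ b) ⊕ c ≡ a ⊕ (b ⊕ c)
⊕-assoc (a , a′) (b , b′) (c , c′) = cong₂ _,_ (+-assoc a b c) (+-assoc a′ b′ c′)

⊕-comm : ∀ a b → a ⊕ b ≡ b ⊕ a
⊕-comm (a , a′) (b , b′) = cong₂ _,_ (+-comm a b) (+-comm a′ b′)

-- The state threaded through labels: the height, and whether a z-label
-- has been met.
State : Set
State = ℕ × Bool

labelsFrom : List Col → State → ℕ × ℕ
labelsFrom cs (h , z) = labels cs h z

next : Col → State → State
next (true , true)   (h , z)     = 2 + h , z
next (false , false) (zero , z)  = zero , z
next (false , false) (suc h , z) = h ∸ 1 , z
next (true , false)  (zero , z)  = zero , true
next (true , false)  (suc h , z) = suc h , z
next (false , true)  s           = s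

yUnless : Bool → ℕ
yUnless true  = 0
yUnless false = 1

emit : Col → State → ℕ × ℕ
emit (true , true)   (zero , z) = yUnless z , 0
emit (false , true)  (zero , z) = yUnless z , 0
emit (true , false)  (zero , z) = 0 , 1
emit (false , false) (zero , z) = 0 , 0
emit _               (suc h , z) = 0 , 0

labels-∷ : ∀ c cs s → labelsFrom (c ∷ cs) s ≡ emit c s ⊕ labelsFrom cs (next c s)
labels-∷ (true , true)   cs (zero , true)  = refl
labels-∷ (true , true)   cs (zero , false) = refl
labels-∷ (true , true)   cs (suc h , z)    = refl
labels-∷ (false , true)  cs (zero , true)  = refl
labels-∷ (false , true)  cs (zero , false) = refl
labels-∷ (false , true)  cs (suc h , z)    = refl
labels-∷ (true , false)  cs (zero , z)     = refl
labels-∷ (true , false)  cs (suc h , z)    = refl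
labels-∷ (false , false) cs (zero , z)     = refl
labels-∷ (false , false) cs (suc h , z)    = refl

after : List Col → State → State
after []       s = s
after (c ∷ cs) s = after cs (next c s)

labels-++ : ∀ xs ys s → labelsFrom (xs ++ ys) s ≡ labelsFrom xs s ⊕ labelsFrom ys (after xs s)
labels-++ []       ys s = refl
labels-++ (c ∷ xs) ys s = begin
  labelsFrom (c ∷ xs ++ ys) s                        ≡⟨ labels-∷ c (xs ++ ys) s ⟩
  emit c s ⊕ labelsFrom (xs ++ ys) (next c s)        ≡⟨ cong (emit c s ⊕_) (labels-++ xs ys (next c s)) ⟩
  emit c s ⊕ (labelsFrom xs (next c s) ⊕ rest)       ≡⟨ sym (⊕-assoc (emit c s) _ rest) ⟩
  emit c s ⊕ labelsFrom xs (next c s) ⊕ rest         ≡⟨ cong (_⊕ rest) (sym (labels-∷ c xs s)) ⟩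
  labelsFrom (c ∷ xs) s ⊕ rest                       ∎
  where
  rest : ℕ × ℕ
  rest = labelsFrom ys (after (c ∷ xs) s)

after-++ : ∀ xs ys s → after (xs ++ ys) s ≡ after ys (after xs s)
after-++ []       ys s = refl
after-++ (c ∷ xs) ys s = after-++ xs ys (next c s)

after-height : ∀ {h h′ cs} → Path h cs h′ → ∀ z → proj₁ (after cs (h , z)) ≡ h′
after-height done       z = refl
after-height (up p)     z = after-height p z
after-height (down p)   z = after-height p z
after-height {zero}  (flat•∘ p) z = after-height p true
after-height {suc h} (flat•∘ p) z = after-height p z
after-height (flat∘• p) z = after-height p z

total : ℕ × ℕ → ℕ
total (y , z) = y + z

total-⊕ : ∀ a b → total (a ⊕ b) ≡ total a + total b
total-⊕ (a , a′) (b , b′) = interchange a b a′ b′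

total-emit≤1 : ∀ c s → total (emit c s) ≤ 1
total-emit≤1 (true , true)   (zero , true)  = z≤n
total-emit≤1 (true , true)   (zero , false) = s≤s z≤n
total-emit≤1 (false , true)  (zero , true)  = z≤n
total-emit≤1 (false , true)  (zero , false) = s≤s z≤n
total-emit≤1 (true , false)  (zero , z)     = s≤s z≤n
total-emit≤1 (false , false) (zero , z)     = z≤n
total-emit≤1 (true , true)   (suc h , z)    = z≤n
total-emit≤1 (false , true)  (suc h , z)    = z≤n
total-emit≤1 (true , false)  (suc h , z)    = z≤n
total-emit≤1 (false , false) (suc h , z)    = z≤n

total-labels≤length : ∀ cs s → total (labelsFrom cs s) ≤ length cs
total-labels≤length []       s = z≤n
total-labels≤length (c ∷ cs) s =
  subst (_≤ length (c ∷ cs)) (sym (trans (cong total (labels-∷ c cs s)) (total-⊕ (emit c s) _)))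
        (+-mono-≤ (total-emit≤1 c s) (total-labels≤length cs (next c s)))

labels-bound : ∀ cs {y z n} → labelsFrom cs (0 , false) ≡ (y , z) → length cs ≡ n → y + z ≤ n
labels-bound cs {n = n} e refl = subst (_≤ n) (cong total e) (total-labels≤length cs (0 , false))

yLabel : State → ℕ × ℕ
yLabel = emit (false , true)

yLabel-next-• : ∀ x s → yLabel (next (true , x) s) ≡ (0 , 0)
yLabel-next-• true  s           = refl
yLabel-next-• false (zero , z)  = refl
yLabel-next-• false (suc h , z) = refl

yLabel-after-• : ∀ xs x s → yLabel (after (xs ++ [ (true , x) ]) s) ≡ (0 , 0)
yLabel-after-• xs x s rewrite after-++ xs [ (true , x) ] s = yLabel-next-• x (after xs s)

labels-∘• : ∀ xs ys s → labelsFrom (xs ++ (false , true) ∷ ys) s ≡ yLabel (after xs s) ⊕ labelsFrom (xs ++ ys) s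
labels-∘• xs ys s = begin
  labelsFrom (xs ++ (false , true) ∷ ys) s
    ≡⟨ labels-++ xs _ s ⟩
  labelsFrom xs s ⊕ labelsFrom ((false , true) ∷ ys) (after xs s)
    ≡⟨ cong (labelsFrom xs s ⊕_) (labels-∷ _ ys (after xs s)) ⟩
  labelsFrom xs s ⊕ (y ⊕ labelsFrom ys (after xs s))
    ≡⟨ sym (⊕-assoc (labelsFrom xs s) y _) ⟩
  labelsFrom xs s ⊕ y ⊕ labelsFrom ys (after xs s)
    ≡⟨ cong (_⊕ labelsFrom ys (after xs s)) (⊕-comm _ y) ⟩
  y ⊕ labelsFrom xs s ⊕ labelsFrom ys (after xs s)
    ≡⟨ ⊕-assoc y (labelsFrom xs s) _ ⟩
  y ⊕ (labelsFrom xs s ⊕ labelsFrom ys (after xs s))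
    ≡⟨ cong (y ⊕_) (sym (labels-++ xs ys s)) ⟩
  y ⊕ labelsFrom (xs ++ ys) s ∎
  where
  y : ℕ × ℕ
  y = yLabel (after xs s)

labels-•∘-last : ∀ xs s → proj₁ (after xs s) ≡ 0 →
                 labelsFrom (xs ++ [ (true , false) ]) s ≡ (0 , 1) ⊕ labelsFrom xs s
labels-•∘-last xs s h≡0 =
  trans (labels-++ xs _ s) (trans (cong (labelsFrom xs s ⊕_) (last (after xs s) h≡0)) (⊕-comm _ (0 , 1)))
  where
  last : ∀ s → proj₁ s ≡ 0 → labelsFrom [ (true , false) ] s ≡ (0 , 1)
  last (zero , z) refl = refl

-- For x = ∘ this needs height ≥ 2 before the peak (at height 0, (•,∘) would
-- carry a z-label); the descent (∘,∘) of the path guarantees it.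
labels-peak : ∀ {h h′} xs x ys z → Path h (xs ++ (false , x) ∷ ys) h′ →
              labelsFrom (xs ++ (true , x) ∷ (false , false) ∷ ys) (h , z) ≡
              labelsFrom (xs ++ (false , x) ∷ ys) (h , z)
labels-peak {h} xs x ys z p =
  trans (labels-++ xs _ (h , z))
        (trans (cong (labelsFrom xs (h , z) ⊕_) (local x (after xs (h , z)) height≥2))
               (sym (labels-++ xs _ (h , z))))
  where
  height≥2 : x ≡ false → 2 ≤ proj₁ (after xs (h , z))
  height≥2 refl with Path-split xs p
  ... | _ , p₁ , down _ = subst (2 ≤_) (sym (after-height p₁ z)) (s≤s (s≤s z≤n))
  local : ∀ x s → (x ≡ false → 2 ≤ proj₁ s) →
          labelsFrom ((true , x) ∷ (false , false) ∷ ys) s ≡ labelsFrom ((false , x) ∷ ys) s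
  local true  (zero , z)        _ = refl
  local true  (suc h , z)       _ = refl
  local false (zero , z)        H with H refl
  ... | ()
  local false (suc zero , z)    H with H refl
  ... | s≤s ()
  local false (suc (suc h) , z) _ = refl

data EmptyOrLastTop (a : Bool) : List Col → Set where
  empty : EmptyOrLastTop a []
  last  : ∀ P x → EmptyOrLastTop a (P ++ [ (a , x) ])

data EmptyOrHeadTop (a : Bool) : List Col → Set where
  empty : EmptyOrHeadTop a []
  head  : ∀ x R → EmptyOrHeadTop a ((a , x) ∷ R)

trailingRun : ∀ a L → Σ[ P ∈ List Col ] Σ[ ws ∈ List Bool ] L ≡ P ++ run a ws × EmptyOrLastTop (not a) P
trailingRun a [] = [] , [] , refl , empty
trailingRun a ((t , w) ∷ L) with trailingRun a L
... | P , ws , refl , last P₀ x₀ = (t , w) ∷ P , ws , refl , last ((t , w) ∷ P₀) x₀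
trailingRun true  ((true , w)  ∷ L) | .[] , ws , refl , empty = [] , w ∷ ws , refl , empty
trailingRun false ((false , w) ∷ L) | .[] , ws , refl , empty = [] , w ∷ ws , refl , empty
trailingRun true  ((false , w) ∷ L) | .[] , ws , refl , empty = [ (false , w) ] , ws , refl , last [] w
trailingRun false ((true , w)  ∷ L) | .[] , ws , refl , empty = [ (true , w) ] , ws , refl , last [] w

leadingRun : ∀ a R → Σ[ ws ∈ List Bool ] Σ[ R′ ∈ List Col ] R ≡ run a ws ++ R′ × EmptyOrHeadTop (not a) R′
leadingRun a [] = [] , [] , refl , empty
leadingRun true  ((false , w) ∷ R) = [] , _ , refl , head w R
leadingRun false ((true , w)  ∷ R) = [] , _ , refl , head w R
leadingRun true  ((true , w)  ∷ R) with leadingRun true R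
... | ws , R′ , refl , h = w ∷ ws , R′ , refl , h
leadingRun false ((false , w) ∷ R) with leadingRun false R
... | ws , R′ , refl , h = w ∷ ws , R′ , refl , h

scanRw : List Bool → ℕ → ℕ → ℕ
scanRw t zero    k = k
scanRw t (suc f) k = if cell t (suc k) then k else scanRw t f (suc k)

scanLb : List Bool → ℕ → ℕ
scanLb t zero    = 0
scanLb t (suc k) = if cell t (suc k) then scanLb t k else suc k

scanL-skip : ∀ t k m → (∀ d → d < m → at0 t (k + d) ≡ false) → scanL t (k + m) ≡ scanL t k
scanL-skip t k zero    _ rewrite +-identityʳ k = refl
scanL-skip t k (suc m) H rewrite +-suc k m =
  trans (if-false (H m ≤-refl)) (scanL-skip t k m (λ d d< → H d (m<n⇒m<1+n d<)))

scanLb-skip : ∀ t k m → (∀ d → d < m → at0 t (k + d) ≡ true) → scanLb t (k + m) ≡ scanLb t k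
scanLb-skip t k zero    _ rewrite +-identityʳ k = refl
scanLb-skip t k (suc m) H rewrite +-suc k m =
  trans (if-true (H m ≤-refl)) (scanLb-skip t k m (λ d d< → H d (m<n⇒m<1+n d<)))

scanR-skip : ∀ t m f k → (∀ d → d < m → at0 t (k + d) ≡ true) → scanR t (m + f) k ≡ scanR t f (k + m)
scanR-skip t zero    f k _ rewrite +-identityʳ k = refl
scanR-skip t (suc m) f k H =
  trans (if-true (subst (λ i → at0 t i ≡ true) (+-identityʳ k) (H 0 (s≤s z≤n))))
        (trans (scanR-skip t m f (suc k) (λ d d< → subst (λ i → at0 t i ≡ true) (+-suc k d) (H (suc d) (s≤s d<))))
               (cong (scanR t f) (sym (+-suc k m))))

scanRw-skip : ∀ t m f k → (∀ d → d < m → at0 t (k + d) ≡ false) → scanRw t (m + f) k ≡ scanRw t f (k + m)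
scanRw-skip t zero    f k _ rewrite +-identityʳ k = refl
scanRw-skip t (suc m) f k H =
  trans (if-false (subst (λ i → at0 t i ≡ false) (+-identityʳ k) (H 0 (s≤s z≤n))))
        (trans (scanRw-skip t m f (suc k) (λ d d< → subst (λ i → at0 t i ≡ false) (+-suc k d) (H (suc d) (s≤s d<))))
               (cong (scanRw t f) (sym (+-suc k m))))

scanL-stop : ∀ {P} → EmptyOrLastTop true P → ∀ rest → scanL (tops P ++ rest) (length P) ≡ length P
scanL-stop empty rest = refl
scanL-stop (last P x) rest
  rewrite tops-++ P [ (true , x) ] | ++-assoc (tops P) [ true ] rest | length-++ P {[ (true , x) ]}
        | +-comm (length P) 1 = if-true (at0-++ (tops P) 0 (sym (trans (+-identityʳ _) (length-tops P))))

-- The inverse map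

-- undoes (a′), and (c) when the scan reaches n
unslide : ℕ → Config → ℕ → Config × ℕ
unslide n (t , b) j =
  let m = scanRw t (n ∸ suc j) (suc j) in
  if m ≡ᵇ n then ((insertAt (n ∸ 1) true (removeAt j t) , insertAt (n ∸ 1) false (removeAt j b)) , n)
  else ((insertAt m false (removeAt j t) , insertAt m true (removeAt j b)) , m)

-- undoes (a″), and (b) when the scan reaches 0
uncarry : ℕ → Config → ℕ → Config × ℕ
uncarry n (t , b) j =
  let m = scanLb t j in
  if m ≡ᵇ 0 then ((insertAt 0 false (removeAt (j ∸ 1) t) , insertAt 0 true (removeAt (wpos n j ∸ 1) b)) , 0)
  else ((insertAt m false (removeAt (m ∸ 1) t) , insertAt m false (removeAt (wpos n j ∸ 1) b)) , m)

Tbar⁻¹ : ℕ → Config → ℕ → Config × ℕ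
Tbar⁻¹ n (t , b) j =
  if j ≡ᵇ 0 then (if not (cell t 1) then unslide n (t , b) j else ((t , b) , j))
  else if j ≡ᵇ n then (if cell t n then uncarry n (t , b) j else ((t , b) , j))
  else if cell t j ∧ not (cell t (suc j)) then
    (if cell b (suc j) then unslide n (t , b) j else uncarry n (t , b) j)
  else ((t , b) , j)

-- Tbar and Tbar⁻¹ move exactly the same pairs (t , i)
active : ℕ → List Bool → ℕ → Bool
active n t i = if i ≡ᵇ 0 then not (cell t 1) else if i ≡ᵇ n then cell t n else (cell t i ∧ not (cell t (suc i)))

Tbar-inactive : ∀ n t b i → active n t i ≡ false → Tbar n (t , b) i ≡ ((t , b) , i)
Tbar-inactive n t b i e with i ≡ᵇ 0 | i ≡ᵇ n | cell t 1 | cell t n | cell t i | cell t (suc i)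
... | true  | _     | true  | _     | _     | _     = refl
... | false | true  | _     | false | _     | _     = refl
... | false | false | _     | _     | false | _     = refl
... | false | false | _     | _     | true  | true  = refl
Tbar-inactive n t b i () | true  | _     | false | _    | _    | _
Tbar-inactive n t b i () | false | true  | _     | true | _    | _
Tbar-inactive n t b i () | false | false | _     | _    | true | false

Tbar⁻¹-inactive : ∀ n t b i → active n t i ≡ false → Tbar⁻¹ n (t , b) i ≡ ((t , b) , i)
Tbar⁻¹-inactive n t b i e with i ≡ᵇ 0 | i ≡ᵇ n | cell t 1 | cell t n | cell t i | cell t (suc i)
... | true  | _     | true  | _     | _     | _     = refl
... | false | true  | _     | false | _     | _     = refl
... | false | false | _     | _     | false | _     = refl
... | false | false | _     | _     | true  | true  = refl
Tbar⁻¹-inactive n t b i () | true  | _     | false | _    | _    | _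
Tbar⁻¹-inactive n t b i () | false | true  | _     | true | _    | _
Tbar⁻¹-inactive n t b i () | false | false | _     | _    | true | false

inactive-0 : ∀ n t → at0 t 0 ≡ true → active n t 0 ≡ false
inactive-0 n t e rewrite e = refl

inactive-n : ∀ m t → at0 t m ≡ false → active (suc m) t (suc m) ≡ false
inactive-n m t e rewrite ≡ᵇ-refl m | e = refl

inactive-white : ∀ n t i → suc i < n → at0 t i ≡ false → active n t (suc i) ≡ false
inactive-white n t i i<n e rewrite <⇒≡ᵇ≡false i<n | e = refl

inactive-black-black : ∀ n t i → suc i < n → at0 t (suc i) ≡ true → active n t (suc i) ≡ false
inactive-black-black n t i i<n e rewrite <⇒≡ᵇ≡false i<n | e with at0 t i
... | true  = refl
... | false = refl

Tbar-a′ : ∀ n t b i → (suc i ≡ᵇ n) ≡ false → at0 t i ≡ true → at0 t (suc i) ≡ false → at0 b (suc i) ≡ true →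
          Tbar n (t , b) (suc i) ≡ caseA' n (t , b) (suc i)
Tbar-a′ n t b i e₁ e₂ e₃ e₄ rewrite e₁ | e₂ | e₃ | e₄ = refl

Tbar-a″ : ∀ n t b i → (suc i ≡ᵇ n) ≡ false → at0 t i ≡ true → at0 t (suc i) ≡ false → at0 b (suc i) ≡ false →
          Tbar n (t , b) (suc i) ≡ caseA'' n (t , b) (suc i)
Tbar-a″ n t b i e₁ e₂ e₃ e₄ rewrite e₁ | e₂ | e₃ | e₄ = refl

Tbar-b : ∀ n t b → at0 t 0 ≡ false → Tbar n (t , b) 0 ≡ caseB n (t , b)
Tbar-b n t b e rewrite e = refl

Tbar-c : ∀ m t b → at0 t m ≡ true → Tbar (suc m) (t , b) (suc m) ≡ caseC (suc m) (t , b)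
Tbar-c m t b e rewrite ≡ᵇ-refl m | e = refl

Tbar⁻¹-unslide₀ : ∀ n t b → at0 t 0 ≡ false → Tbar⁻¹ n (t , b) 0 ≡ unslide n (t , b) 0
Tbar⁻¹-unslide₀ n t b e rewrite e = refl

Tbar⁻¹-unslide : ∀ n t b j → (suc j ≡ᵇ n) ≡ false → at0 t j ≡ true → at0 t (suc j) ≡ false →
                 at0 b (suc j) ≡ true → Tbar⁻¹ n (t , b) (suc j) ≡ unslide n (t , b) (suc j)
Tbar⁻¹-unslide n t b j e₁ e₂ e₃ e₄ rewrite e₁ | e₂ | e₃ | e₄ = refl

Tbar⁻¹-uncarry : ∀ n t b j → (suc j ≡ᵇ n) ≡ false → at0 t j ≡ true → at0 t (suc j) ≡ false →
                 at0 b (suc j) ≡ false → Tbar⁻¹ n (t , b) (suc j) ≡ uncarry n (t , b) (suc j)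
Tbar⁻¹-uncarry n t b j e₁ e₂ e₃ e₄ rewrite e₁ | e₂ | e₃ | e₄ = refl

Tbar⁻¹-uncarryₙ : ∀ m t b → at0 t m ≡ true → Tbar⁻¹ (suc m) (t , b) (suc m) ≡ uncarry (suc m) (t , b) (suc m)
Tbar⁻¹-uncarryₙ m t b e rewrite ≡ᵇ-refl m | e = refl

Tbar⁻¹-unslide-after : ∀ n {P} → EmptyOrLastTop true P → ∀ rest b → length P < n → at0 rest 0 ≡ false →
                       at0 b (length P) ≡ true →
                       Tbar⁻¹ n (tops P ++ rest , b) (length P) ≡ unslide n (tops P ++ rest , b) (length P)
Tbar⁻¹-unslide-after n empty rest b _ top _ = Tbar⁻¹-unslide₀ n rest b top
Tbar⁻¹-unslide-after n (last P x) rest b P<n top bot =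
  subst₂ (λ t k → Tbar⁻¹ n (t , b) k ≡ unslide n (t , b) k) (sym rows) (sym len)
    (Tbar⁻¹-unslide n (tops P ++ true ∷ rest) b (length P) (<⇒≡ᵇ≡false (subst (_< n) len P<n))
       (at0-++ (tops P) 0 (sym (trans (+-identityʳ _) (length-tops P))))
       (trans (at0-++ (tops P) 1 (sym (trans (+-comm _ 1) (cong suc (length-tops P))))) top)
       (subst (λ k → at0 b k ≡ true) len bot))
  where
  len : length (P ++ [ (true , x) ]) ≡ suc (length P)
  len = trans (length-++ P) (+-comm (length P) 1)
  rows : tops (P ++ [ (true , x) ]) ++ rest ≡ tops P ++ true ∷ rest
  rows = trans (cong (_++ rest) (tops-++ P _)) (++-assoc (tops P) _ rest)

caseA′-eval : ∀ n t b i {j₁} → scanL t (i ∸ 1) ≡ j₁ →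
  caseA' n (t , b) i ≡ ((insertAt j₁ (cell t (suc i)) (removeAt i t) , insertAt j₁ (cell b (suc i)) (removeAt i b)) , j₁)
caseA′-eval n t b i refl = refl

caseC-eval : ∀ n t b {j₁} → scanL t (n ∸ 1) ≡ j₁ →
  caseC n (t , b) ≡ ((insertAt j₁ false (removeAt (n ∸ 1) t) , insertAt j₁ true (removeAt (n ∸ 1) b)) , j₁)
caseC-eval n t b refl = refl

caseA″-eval : ∀ n t b i {j₂} → scanR t (n ∸ suc i) (suc i) ≡ j₂ →
  caseA'' n (t , b) i ≡
  ((insertAt (j₂ ∸ 1) true (removeAt (i ∸ 1) t) , insertAt (wpos n j₂ ∸ 1) false (removeAt i b)) , j₂)
caseA″-eval n t b i refl = refl

caseB-eval : ∀ n t b {j₂} → scanR t (n ∸ 1) 1 ≡ j₂ →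
  caseB n (t , b) ≡ ((insertAt (j₂ ∸ 1) true (removeAt 0 t) , insertAt (wpos n j₂ ∸ 1) false (removeAt 0 b)) , j₂)
caseB-eval n t b refl = refl

unslide-< : ∀ n t b j {m} → scanRw t (n ∸ suc j) (suc j) ≡ m → m < n →
  unslide n (t , b) j ≡ ((insertAt m false (removeAt j t) , insertAt m true (removeAt j b)) , m)
unslide-< n t b j refl m<n = if-false (<⇒≡ᵇ≡false m<n)

unslide-n : ∀ n t b j → scanRw t (n ∸ suc j) (suc j) ≡ n →
  unslide n (t , b) j ≡ ((insertAt (n ∸ 1) true (removeAt j t) , insertAt (n ∸ 1) false (removeAt j b)) , n)
unslide-n n t b j e = if-true (trans (cong (_≡ᵇ n) e) (≡ᵇ-refl n))

uncarry-0 : ∀ n t b j → scanLb t j ≡ 0 →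
  uncarry n (t , b) j ≡ ((insertAt 0 false (removeAt (j ∸ 1) t) , insertAt 0 true (removeAt (wpos n j ∸ 1) b)) , 0)
uncarry-0 n t b j e = if-true (cong (_≡ᵇ 0) e)

uncarry-suc : ∀ n t b j {m} → scanLb t j ≡ suc m →
  uncarry n (t , b) j ≡
  ((insertAt (suc m) false (removeAt m t) , insertAt (suc m) false (removeAt (wpos n j ∸ 1) b)) , suc m)
uncarry-suc n t b j e rewrite e = refl

Exponents : Set
Exponents = ℕ × ℕ × ℕ

αᵉ βᵉ γᵉ : Exponents
αᵉ = 1 , 0 , 0
βᵉ = 0 , 1 , 0
γᵉ = 0 , 0 , 1

lamᵉ : ℕ → ℕ → Exponents
lamᵉ n i = if i ≡ᵇ 0 then βᵉ else if i ≡ᵇ n then γᵉ else αᵉ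

weighᵉ : ℕ → Exponents → ℕ × ℕ → Exponents
weighᵉ n (a , b , c) (y , z) = a + (y + z) , b + (n ∸ y) , c + (n ∸ z)

exponents : ℕ → ℕ → List Col → Exponents
exponents n i cs = weighᵉ n (lamᵉ n i) (labelsFrom cs (0 , false))

lamᵉ-n : ∀ n → 1 ≤ n → lamᵉ n n ≡ γᵉ
lamᵉ-n (suc n) _ = if-true (≡ᵇ-refl n)

lamᵉ-inside : ∀ n i → 1 ≤ i → i < n → lamᵉ n i ≡ αᵉ
lamᵉ-inside n (suc i) _ i<n = if-false (<⇒≡ᵇ≡false i<n)

weighᵉ-α≡β : ∀ n y z → suc y ≤ n → weighᵉ n αᵉ (y , z) ≡ weighᵉ n βᵉ (suc y , z)
weighᵉ-α≡β n y z y<n = cong (λ b → suc (y + z) , b , n ∸ z) (+-∸-assoc 1 y<n)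

weighᵉ-γ≡α : ∀ n y z → suc z ≤ n → weighᵉ n γᵉ (y , suc z) ≡ weighᵉ n αᵉ (y , z)
weighᵉ-γ≡α n y z z<n = cong₂ (λ a c → a , n ∸ y , c) (+-suc y z) (sym (+-∸-assoc 1 z<n))

weighᵉ-γ≡β : ∀ n y z → suc y ≤ n → suc z ≤ n → weighᵉ n γᵉ (y , suc z) ≡ weighᵉ n βᵉ (suc y , z)
weighᵉ-γ≡β n y z y<n z<n = trans (weighᵉ-γ≡α n y z z<n) (weighᵉ-α≡β n y z y<n)

record Step (n : ℕ) (cs : List Col) (i : ℕ) : Set where
  field
    cs′        : List Col
    j          : ℕ
    Tbar≡      : Tbar n (cols cs) i ≡ (cols cs′ , j)
    Tbar⁻¹≡    : Tbar⁻¹ n (cols cs′) j ≡ (cols cs , i)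
    length≡    : length cs′ ≡ n
    path       : Path 0 cs′ 0
    j≤n        : j ≤ n
    exponents≡ : exponents n i cs ≡ exponents n j cs′

record Preimage (n : ℕ) (cs′ : List Col) (j : ℕ) : Set where
  field
    cs      : List Col
    i       : ℕ
    Tbar≡   : Tbar n (cols cs) i ≡ (cols cs′ , j)
    length≡ : length cs ≡ n
    path    : Path 0 cs 0
    i≤n     : i ≤ n

-- Case (a′): the flat column (∘,•) slides left across the white tops

module CaseA′ (P : List Col) (ws : List Bool) (x : Bool) (R : List Col) where
  D E : List Col
  D = P ++ run false ws ++ (true , x) ∷ (false , true) ∷ R
  E = P ++ (false , true) ∷ run false ws ++ (true , x) ∷ R

  p w i n : ℕ
  p = length P
  w = length ws
  i = suc (p + w)
  n = i + suc (length R)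

  i<n : i < n
  i<n = m<m+n i (s≤s z≤n)

  length-D : length D ≡ n
  length-D = trans (length-shape P [] false ws _) (arith p w (length R))
    where
    arith : ∀ p w r → p + (w + suc (suc r)) ≡ suc (p + w) + suc r
    arith = solve-∀

  length-E : length E ≡ n
  length-E = trans (length-shape P [ (false , true) ] false ws _) (arith p w (length R))
    where
    arith : ∀ p w r → p + suc (w + suc r) ≡ suc (p + w) + suc r
    arith = solve-∀

  private
    W : List Bool
    W = replicate w false
    tD bD tE bE : List Bool
    tD = tops P ++ W ++ true ∷ false ∷ tops R
    bD = bots P ++ ws ++ x ∷ true ∷ bots R
    tE = tops P ++ false ∷ W ++ true ∷ tops R
    bE = bots P ++ true ∷ ws ++ x ∷ bots R

    cols-D : cols D ≡ (tD , bD)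
    cols-D = cols-shape P [] false ws _
    cols-E : cols E ≡ (tE , bE)
    cols-E = cols-shape P [ (false , true) ] false ws _

    W-offset : ∀ d → p + (w + d) ≡ length (tops P) + (length W + d)
    W-offset d = cong₂ (λ a b → a + (b + d)) (sym (length-tops P)) (sym (length-replicate w))
    W-end : w ≡ length W + 0
    W-end = sym (trans (+-identityʳ _) (length-replicate w))
    ws-offset : ∀ d → p + (w + d) ≡ length (bots P) + (length ws + d)
    ws-offset d = cong (_+ (w + d)) (sym (length-bots P))
    i≡ : i ≡ p + (w + 1)
    i≡ = arith p w
      where
      arith : ∀ p w → suc (p + w) ≡ p + (w + 1)
      arith = solve-∀

  forward : EmptyOrLastTop true P → Tbar n (cols D) i ≡ (cols E , p)
  forward stop = begin
    Tbar n (cols D) i      ≡⟨ cong (λ ω → Tbar n ω i) cols-D ⟩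
    Tbar n (tD , bD) i     ≡⟨ Tbar-a′ n tD bD (p + w) (<⇒≡ᵇ≡false i<n) top-i-1 top-i bot-i ⟩
    caseA' n (tD , bD) i   ≡⟨ caseA′-eval n tD bD i scan ⟩
    ((insertAt p (at0 tD i) (removeAt i tD) , insertAt p (at0 bD i) (removeAt i bD)) , p)
                           ≡⟨ cong₂ (λ t b → ((t , b) , p)) top bot ⟩
    ((tE , bE) , p)        ≡⟨ cong (_, p) (sym cols-E) ⟩
    (cols E , p)           ∎
    where
    top-i-1 : at0 tD (p + w) ≡ true
    top-i-1 = at0-++-++ (tops P) W 0 (trans (cong (p +_) (sym (+-identityʳ w))) (W-offset 0))
    top-i : at0 tD i ≡ false
    top-i = at0-++-++ (tops P) W 1 (trans i≡ (W-offset 1))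
    bot-i : at0 bD i ≡ true
    bot-i = at0-++-++ (bots P) ws 1 (trans i≡ (ws-offset 1))
    run-white : ∀ d → d < w → at0 tD (p + d) ≡ false
    run-white d d<w = trans (at0-++ (tops P) d (tops-offset P d refl)) (at0-replicate-++ w false d d<w)
    scan : scanL tD (p + w) ≡ p
    scan = trans (scanL-skip tD p w run-white) (scanL-stop stop _)
    top : insertAt p (at0 tD i) (removeAt i tD) ≡ tE
    top = trans (cong₂ (insertAt p) top-i (removeAt-++-++ (tops P) W 1 (trans i≡ (W-offset 1))))
                (insertAt-++ (tops P) 0 false (tops-offset P 0 (sym (+-identityʳ p))))
    bot : insertAt p (at0 bD i) (removeAt i bD) ≡ bE
    bot = trans (cong₂ (insertAt p) bot-i (removeAt-++-++ (bots P) ws 1 (trans i≡ (ws-offset 1))))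
                (insertAt-++ (bots P) 0 true (bots-offset P 0 (sym (+-identityʳ p))))

  backward : EmptyOrLastTop true P → Tbar⁻¹ n (cols E) p ≡ (cols D , i)
  backward stop = begin
    Tbar⁻¹ n (cols E) p    ≡⟨ cong (λ ω → Tbar⁻¹ n ω p) cols-E ⟩
    Tbar⁻¹ n (tE , bE) p   ≡⟨ Tbar⁻¹-unslide-after n stop _ bE p<n refl bot-p ⟩
    unslide n (tE , bE) p  ≡⟨ unslide-< n tE bE p scan i<n ⟩
    ((insertAt i false (removeAt p tE) , insertAt i true (removeAt p bE)) , i)
                           ≡⟨ cong₂ (λ t b → ((t , b) , i)) top bot ⟩
    ((tD , bD) , i)        ≡⟨ cong (_, i) (sym cols-D) ⟩
    (cols D , i)           ∎
    where
    p<n : p < n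
    p<n = <-trans (s≤s (m≤m+n p w)) i<n
    bot-p : at0 bE p ≡ true
    bot-p = at0-++ (bots P) 0 (bots-offset P 0 (sym (+-identityʳ p)))
    run-white : ∀ d → d < w → at0 tE (suc p + d) ≡ false
    run-white d d<w =
      trans (at0-++ (tops P) (suc d) (tops-offset P (suc d) (sym (+-suc p d)))) (at0-replicate-++ w false d d<w)
    run-end : at0 tE (suc p + w) ≡ true
    run-end = trans (at0-++ (tops P) (suc w) (tops-offset P (suc w) (sym (+-suc p w)))) (at0-++ W 0 W-end)
    range : n ∸ suc p ≡ w + suc (length R)
    range = trans (cong (_∸ suc p) (+-assoc (suc p) w _)) (m+n∸m≡n (suc p) _)
    scan : scanRw tE (n ∸ suc p) (suc p) ≡ i
    scan = begin
      scanRw tE (n ∸ suc p) (suc p)          ≡⟨ cong (λ f → scanRw tE f (suc p)) range ⟩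
      scanRw tE (w + suc (length R)) (suc p) ≡⟨ scanRw-skip tE w _ (suc p) run-white ⟩
      scanRw tE (suc (length R)) i           ≡⟨ if-true run-end ⟩
      i                                      ∎
    top : insertAt i false (removeAt p tE) ≡ tD
    top = trans (cong (insertAt i false) (removeAt-++ (tops P) 0 (tops-offset P 0 (sym (+-identityʳ p)))))
                (insertAt-++-++ (tops P) W 1 false (trans i≡ (W-offset 1)))
    bot : insertAt i true (removeAt p bE) ≡ bD
    bot = trans (cong (insertAt i true) (removeAt-++ (bots P) 0 (bots-offset P 0 (sym (+-identityʳ p)))))
                (insertAt-++-++ (bots P) ws 1 true (trans i≡ (ws-offset 1)))

  private
    X Y : List Col
    X = (P ++ run false ws) ++ [ (true , x) ]
    Y = run false ws ++ (true , x) ∷ R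

    D≡ : D ≡ X ++ (false , true) ∷ R
    D≡ = assoc-snoc P (run false ws) (true , x) _
    PY≡XR : P ++ Y ≡ X ++ R
    PY≡XR = assoc-snoc P (run false ws) (true , x) R

  path-D⇒E : ∀ {h h′} → Path h D h′ → Path h E h′
  path-D⇒E q = insertFlat P false (Path-resp (sym PY≡XR) (removeFlat X false (Path-resp D≡ q)))

  path-E⇒D : ∀ {h h′} → Path h E h′ → Path h D h′
  path-E⇒D q = Path-resp (sym D≡) (insertFlat X false (Path-resp PY≡XR (removeFlat P false q)))

  private
    L : ℕ × ℕ
    L = labelsFrom (X ++ R) (0 , false)

    labels-D : labelsFrom D (0 , false) ≡ L
    labels-D = trans (cong (λ cs → labelsFrom cs (0 , false)) D≡)
                     (trans (labels-∘• X R _) (cong (_⊕ L) (yLabel-after-• (P ++ run false ws) x _)))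
    labels-E : labelsFrom E (0 , false) ≡ yLabel (after P (0 , false)) ⊕ L
    labels-E = trans (labels-∘• P Y _) (cong (λ cs → yLabel (after P (0 , false)) ⊕ labelsFrom cs (0 , false)) PY≡XR)

  exponents≡ : EmptyOrLastTop true P → exponents n i D ≡ exponents n p E
  exponents≡ empty = begin
    weighᵉ n (lamᵉ n i) (labelsFrom D (0 , false))
      ≡⟨ cong₂ (weighᵉ n) (lamᵉ-inside n i (s≤s z≤n) i<n) labels-D ⟩
    weighᵉ n αᵉ L
      ≡⟨ weighᵉ-α≡β n (proj₁ L) (proj₂ L) (≤-trans (m≤m+n _ _) (labels-bound E labels-E length-E)) ⟩
    weighᵉ n βᵉ ((1 , 0) ⊕ L)
      ≡⟨ cong (weighᵉ n βᵉ) (sym labels-E) ⟩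
    weighᵉ n (lamᵉ n 0) (labelsFrom E (0 , false)) ∎
  exponents≡ (last P₀ x₀) = begin
    weighᵉ n (lamᵉ n i) (labelsFrom D (0 , false))
      ≡⟨ cong₂ (weighᵉ n) (lamᵉ-inside n i (s≤s z≤n) i<n) labels-D ⟩
    weighᵉ n αᵉ L
      ≡⟨ cong₂ (weighᵉ n) (sym (lamᵉ-inside n p 1≤p p<n))
               (sym (trans labels-E (cong (_⊕ L) (yLabel-after-• P₀ x₀ _)))) ⟩
    weighᵉ n (lamᵉ n p) (labelsFrom E (0 , false)) ∎
    where
    1≤p : 1 ≤ p
    1≤p = subst (1 ≤_) (sym (trans (length-++ P₀) (+-comm _ 1))) (s≤s z≤n)
    p<n : p < n
    p<n = <-trans (s≤s (m≤m+n p w)) i<n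

  step : EmptyOrLastTop true P → Path 0 D 0 → Step n D i
  step stop q = record
    { cs′ = E ; j = p ; Tbar≡ = forward stop ; Tbar⁻¹≡ = backward stop ; length≡ = length-E
    ; path = path-D⇒E q ; j≤n = ≤-trans (m≤m+n p w) (≤-trans (n≤1+n _) (<⇒≤ i<n))
    ; exponents≡ = exponents≡ stop }

  preimage : EmptyOrLastTop true P → Path 0 E 0 → Preimage n E p
  preimage stop q = record
    { cs = D ; i = i ; Tbar≡ = forward stop ; length≡ = length-D ; path = path-E⇒D q ; i≤n = <⇒≤ i<n }

-- Case (c): the last column (•,∘) becomes (∘,•) left of the white tops

module CaseC (P : List Col) (ws : List Bool) where
  D E : List Col
  D = P ++ run false ws ++ [ (true , false) ]
  E = P ++ (false , true) ∷ run false ws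

  p w n : ℕ
  p = length P
  w = length ws
  n = suc (p + w)

  p<n : p < n
  p<n = s≤s (m≤m+n p w)

  length-D : length D ≡ n
  length-D = trans (length-shape P [] false ws _) (arith p w)
    where
    arith : ∀ p w → p + (w + 1) ≡ suc (p + w)
    arith = solve-∀

  length-E : length E ≡ n
  length-E = trans (length-++ P) (trans (cong (λ k → p + suc k) (length-run false ws)) (+-suc p w))

  private
    W : List Bool
    W = replicate w false
    tD bD tE bE : List Bool
    tD = tops P ++ W ++ [ true ]
    bD = bots P ++ ws ++ [ false ]
    tE = tops P ++ false ∷ W ++ []
    bE = bots P ++ true ∷ ws ++ []

    cols-D : cols D ≡ (tD , bD)
    cols-D = cols-shape P [] false ws _
    cols-E : cols E ≡ (tE , bE)
    cols-E = cols-shape-end P [ (false , true) ] false ws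

    W-offset : p + w ≡ length (tops P) + (length W + 0)
    W-offset = cong₂ _+_ (sym (length-tops P)) (sym (trans (+-identityʳ _) (length-replicate w)))
    ws-offset : p + w ≡ length (bots P) + (length ws + 0)
    ws-offset = cong₂ _+_ (sym (length-bots P)) (sym (+-identityʳ w))

  forward : EmptyOrLastTop true P → Tbar n (cols D) n ≡ (cols E , p)
  forward stop = begin
    Tbar n (cols D) n    ≡⟨ cong (λ ω → Tbar n ω n) cols-D ⟩
    Tbar n (tD , bD) n   ≡⟨ Tbar-c (p + w) tD bD (at0-++-++ (tops P) W 0 W-offset) ⟩
    caseC n (tD , bD)    ≡⟨ caseC-eval n tD bD scan ⟩
    ((insertAt p false (removeAt (p + w) tD) , insertAt p true (removeAt (p + w) bD)) , p)
                         ≡⟨ cong₂ (λ t b → ((t , b) , p)) top bot ⟩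
    ((tE , bE) , p)      ≡⟨ cong (_, p) (sym cols-E) ⟩
    (cols E , p)         ∎
    where
    run-white : ∀ d → d < w → at0 tD (p + d) ≡ false
    run-white d d<w = trans (at0-++ (tops P) d (tops-offset P d refl)) (at0-replicate-++ w false d d<w)
    scan : scanL tD (p + w) ≡ p
    scan = trans (scanL-skip tD p w run-white) (scanL-stop stop _)
    top : insertAt p false (removeAt (p + w) tD) ≡ tE
    top = trans (cong (insertAt p false) (removeAt-++-++ (tops P) W 0 W-offset))
                (insertAt-++ (tops P) 0 false (tops-offset P 0 (sym (+-identityʳ p))))
    bot : insertAt p true (removeAt (p + w) bD) ≡ bE
    bot = trans (cong (insertAt p true) (removeAt-++-++ (bots P) ws 0 ws-offset))
                (insertAt-++ (bots P) 0 true (bots-offset P 0 (sym (+-identityʳ p))))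

  backward : EmptyOrLastTop true P → Tbar⁻¹ n (cols E) p ≡ (cols D , n)
  backward stop = begin
    Tbar⁻¹ n (cols E) p    ≡⟨ cong (λ ω → Tbar⁻¹ n ω p) cols-E ⟩
    Tbar⁻¹ n (tE , bE) p   ≡⟨ Tbar⁻¹-unslide-after n stop _ bE p<n refl bot-p ⟩
    unslide n (tE , bE) p  ≡⟨ unslide-n n tE bE p scan ⟩
    ((insertAt (p + w) true (removeAt p tE) , insertAt (p + w) false (removeAt p bE)) , n)
                           ≡⟨ cong₂ (λ t b → ((t , b) , n)) top bot ⟩
    ((tD , bD) , n)        ≡⟨ cong (_, n) (sym cols-D) ⟩
    (cols D , n)           ∎
    where
    bot-p : at0 bE p ≡ true
    bot-p = at0-++ (bots P) 0 (bots-offset P 0 (sym (+-identityʳ p)))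
    run-white : ∀ d → d < w → at0 tE (suc p + d) ≡ false
    run-white d d<w =
      trans (at0-++ (tops P) (suc d) (tops-offset P (suc d) (sym (+-suc p d)))) (at0-replicate-++ w false d d<w)
    range : n ∸ suc p ≡ w + 0
    range = trans (m+n∸m≡n (suc p) w) (sym (+-identityʳ w))
    scan : scanRw tE (n ∸ suc p) (suc p) ≡ n
    scan = begin
      scanRw tE (n ∸ suc p) (suc p) ≡⟨ cong (λ f → scanRw tE f (suc p)) range ⟩
      scanRw tE (w + 0) (suc p)     ≡⟨ scanRw-skip tE w 0 (suc p) run-white ⟩
      n                             ∎
    top : insertAt (p + w) true (removeAt p tE) ≡ tD
    top = trans (cong (insertAt (p + w) true) (removeAt-++ (tops P) 0 (tops-offset P 0 (sym (+-identityʳ p)))))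
                (insertAt-++-++ (tops P) W 0 true W-offset)
    bot : insertAt (p + w) false (removeAt p bE) ≡ bD
    bot = trans (cong (insertAt (p + w) false) (removeAt-++ (bots P) 0 (bots-offset P 0 (sym (+-identityʳ p)))))
                (insertAt-++-++ (bots P) ws 0 false ws-offset)

  private
    X : List Col
    X = P ++ run false ws

    D≡ : D ≡ X ++ [ (true , false) ]
    D≡ = sym (++-assoc P (run false ws) _)

  path-D⇒E : ∀ {h h′} → Path h D h′ → Path h E h′
  path-D⇒E q = insertFlat P false (Path-resp (++-identityʳ X) (removeFlat X true (Path-resp D≡ q)))

  path-E⇒D : ∀ {h h′} → Path h E h′ → Path h D h′
  path-E⇒D q = Path-resp (sym D≡) (insertFlat X true (Path-resp (sym (++-identityʳ X)) (removeFlat P false q)))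

  private
    L : ℕ × ℕ
    L = labelsFrom X (0 , false)

    labels-D : Path 0 D 0 → labelsFrom D (0 , false) ≡ (0 , 1) ⊕ L
    labels-D q = trans (cong (λ cs → labelsFrom cs (0 , false)) D≡) (labels-•∘-last X _ X-ends-at-0)
      where
      X-ends-at-0 : proj₁ (after X (0 , false)) ≡ 0
      X-ends-at-0 with Path-split X (Path-resp D≡ q)
      ... | _ , q₁ , flat•∘ done = after-height q₁ false

    labels-E : labelsFrom E (0 , false) ≡ yLabel (after P (0 , false)) ⊕ L
    labels-E = labels-∘• P (run false ws) _

  exponents≡ : EmptyOrLastTop true P → Path 0 D 0 → exponents n n D ≡ exponents n p E
  exponents≡ empty q = begin
    weighᵉ n (lamᵉ n n) (labelsFrom D (0 , false)) ≡⟨ cong₂ (weighᵉ n) (lamᵉ-n n (s≤s z≤n)) (labels-D q) ⟩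
    weighᵉ n γᵉ ((0 , 1) ⊕ L)                      ≡⟨ weighᵉ-γ≡β n (proj₁ L) (proj₂ L) y<n z<n ⟩
    weighᵉ n βᵉ ((1 , 0) ⊕ L)                      ≡⟨ cong (weighᵉ n βᵉ) (sym labels-E) ⟩
    weighᵉ n (lamᵉ n 0) (labelsFrom E (0 , false)) ∎
    where
    y<n : suc (proj₁ L) ≤ n
    y<n = ≤-trans (m≤m+n _ _) (labels-bound E labels-E length-E)
    z<n : suc (proj₂ L) ≤ n
    z<n = ≤-trans (m≤n+m _ _) (labels-bound D (labels-D q) length-D)
  exponents≡ (last P₀ x₀) q = begin
    weighᵉ n (lamᵉ n n) (labelsFrom D (0 , false))
      ≡⟨ cong₂ (weighᵉ n) (lamᵉ-n n (s≤s z≤n)) (labels-D q) ⟩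
    weighᵉ n γᵉ ((0 , 1) ⊕ L)
      ≡⟨ weighᵉ-γ≡α n (proj₁ L) (proj₂ L) z<n ⟩
    weighᵉ n αᵉ L
      ≡⟨ cong₂ (weighᵉ n) (sym (lamᵉ-inside n p 1≤p p<n))
               (sym (trans labels-E (cong (_⊕ L) (yLabel-after-• P₀ x₀ _)))) ⟩
    weighᵉ n (lamᵉ n p) (labelsFrom E (0 , false)) ∎
    where
    z<n : suc (proj₂ L) ≤ n
    z<n = ≤-trans (m≤n+m _ _) (labels-bound D (labels-D q) length-D)
    1≤p : 1 ≤ p
    1≤p = subst (1 ≤_) (sym (trans (length-++ P₀) (+-comm _ 1))) (s≤s z≤n)

  step : EmptyOrLastTop true P → Path 0 D 0 → Step n D n
  step stop q = record
    { cs′ = E ; j = p ; Tbar≡ = forward stop ; Tbar⁻¹≡ = backward stop ; length≡ = length-E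
    ; path = path-D⇒E q ; j≤n = <⇒≤ p<n ; exponents≡ = exponents≡ stop q }

  preimage : EmptyOrLastTop true P → Path 0 E 0 → Preimage n E p
  preimage stop q = record
    { cs = D ; i = n ; Tbar≡ = forward stop ; length≡ = length-D ; path = path-E⇒D q ; i≤n = ≤-refl }

-- Case (a″) with j₂ < n: the peak (•,x)(∘,∘) is carried right across the black tops

module CaseA″ (P : List Col) (x : Bool) (kb : List Bool) (y : Bool) (R : List Col) where
  D E M : List Col
  D = P ++ (true , x) ∷ (false , false) ∷ run true kb ++ (false , y) ∷ R
  E = P ++ (false , x) ∷ run true kb ++ (true , y) ∷ (false , false) ∷ R
  M = P ++ (false , x) ∷ run true kb ++ (false , y) ∷ R

  p k i j n : ℕ
  p = length P
  k = length kb
  i = suc p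
  j = suc (suc (p + k))
  n = j + suc (length R)

  j<n : j < n
  j<n = m<m+n j (s≤s z≤n)

  i<n : i < n
  i<n = <-trans (s≤s (s≤s (m≤m+n p k))) j<n

  length-D : length D ≡ n
  length-D = trans (length-shape P ((true , x) ∷ (false , false) ∷ []) true kb _) (arith p k (length R))
    where
    arith : ∀ p k r → p + (2 + (k + suc r)) ≡ suc (suc (p + k)) + suc r
    arith = solve-∀

  length-E : length E ≡ n
  length-E = trans (length-shape P [ (false , x) ] true kb _) (arith p k (length R))
    where
    arith : ∀ p k r → p + (1 + (k + suc (suc r))) ≡ suc (suc (p + k)) + suc r
    arith = solve-∀

  private
    K : List Bool
    K = replicate k true
    tD bD tE bE : List Bool
    tD = tops P ++ true ∷ false ∷ K ++ false ∷ tops R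
    bD = bots P ++ x ∷ false ∷ kb ++ y ∷ bots R
    tE = tops P ++ false ∷ K ++ true ∷ false ∷ tops R
    bE = bots P ++ x ∷ kb ++ y ∷ false ∷ bots R

    cols-D : cols D ≡ (tD , bD)
    cols-D = cols-shape P ((true , x) ∷ (false , false) ∷ []) true kb _
    cols-E : cols E ≡ (tE , bE)
    cols-E = cols-shape P [ (false , x) ] true kb _

    after-K : ∀ d → suc (suc (p + d)) ≡ length (tops P) + (2 + d)
    after-K d = tops-offset P (2 + d) (arith p d)
      where
      arith : ∀ p d → suc (suc (p + d)) ≡ p + (2 + d)
      arith = solve-∀
    K-end : k ≡ length K + 0
    K-end = sym (trans (+-identityʳ _) (length-replicate k))

  forward : Tbar n (cols D) i ≡ (cols E , j)
  forward = begin
    Tbar n (cols D) i      ≡⟨ cong (λ ω → Tbar n ω i) cols-D ⟩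
    Tbar n (tD , bD) i     ≡⟨ Tbar-a″ n tD bD p (<⇒≡ᵇ≡false i<n) top-p top-i bot-i ⟩
    caseA'' n (tD , bD) i  ≡⟨ caseA″-eval n tD bD i scan ⟩
    ((insertAt (suc (p + k)) true (removeAt p tD) , insertAt (wpos n j ∸ 1) false (removeAt i bD)) , j)
                           ≡⟨ cong₂ (λ t b → ((t , b) , j)) top bot ⟩
    ((tE , bE) , j)        ≡⟨ cong (_, j) (sym cols-E) ⟩
    (cols E , j)           ∎
    where
    top-p : at0 tD p ≡ true
    top-p = at0-++ (tops P) 0 (tops-offset P 0 (sym (+-identityʳ p)))
    top-i : at0 tD i ≡ false
    top-i = at0-++ (tops P) 1 (tops-offset P 1 (+-comm 1 p))
    bot-i : at0 bD i ≡ false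
    bot-i = at0-++ (bots P) 1 (bots-offset P 1 (+-comm 1 p))
    run-black : ∀ d → d < k → at0 tD (suc i + d) ≡ true
    run-black d d<k = trans (at0-++ (tops P) (2 + d) (after-K d)) (at0-replicate-++ k true d d<k)
    run-end : at0 tD (suc i + k) ≡ false
    run-end = trans (at0-++ (tops P) (2 + k) (after-K k)) (at0-++ K 0 K-end)
    range : n ∸ suc i ≡ k + suc (length R)
    range = trans (cong (_∸ suc i) (+-assoc (suc i) k _)) (m+n∸m≡n (suc i) _)
    scan : scanR tD (n ∸ suc i) (suc i) ≡ j
    scan = begin
      scanR tD (n ∸ suc i) (suc i)          ≡⟨ cong (λ f → scanR tD f (suc i)) range ⟩
      scanR tD (k + suc (length R)) (suc i) ≡⟨ scanR-skip tD k _ (suc i) run-black ⟩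
      scanR tD (suc (length R)) j           ≡⟨ if-false run-end ⟩
      j                                     ∎
    top : insertAt (suc (p + k)) true (removeAt p tD) ≡ tE
    top = trans (cong (insertAt (suc (p + k)) true) (removeAt-++ (tops P) 0 (tops-offset P 0 (sym (+-identityʳ p)))))
                (insertAt-++-++ (tops P) (false ∷ K) 0 true
                   (tops-offset P _ (trans (arith p k) (cong (λ m → p + (suc m + 0)) (sym (length-replicate k))))))
      where
      arith : ∀ p k → suc (p + k) ≡ p + (suc k + 0)
      arith = solve-∀
    bot : insertAt (wpos n j ∸ 1) false (removeAt i bD) ≡ bE
    bot = trans (cong₂ (λ m → insertAt (m ∸ 1) false) (wpos-< j<n) (removeAt-++ (bots P) 1 (bots-offset P 1 (+-comm 1 p))))
                (insertAt-++-++ (bots P) (x ∷ kb) 1 false (bots-offset P _ (arith p k)))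
      where
      arith : ∀ p k → suc (suc (p + k)) ≡ p + (suc k + 1)
      arith = solve-∀

  backward : Tbar⁻¹ n (cols E) j ≡ (cols D , i)
  backward = begin
    Tbar⁻¹ n (cols E) j    ≡⟨ cong (λ ω → Tbar⁻¹ n ω j) cols-E ⟩
    Tbar⁻¹ n (tE , bE) j   ≡⟨ Tbar⁻¹-uncarry n tE bE (suc (p + k)) (<⇒≡ᵇ≡false j<n) top-j-1 top-j bot-j ⟩
    uncarry n (tE , bE) j  ≡⟨ uncarry-suc n tE bE j scan ⟩
    ((insertAt i false (removeAt p tE) , insertAt i false (removeAt (wpos n j ∸ 1) bE)) , i)
                           ≡⟨ cong₂ (λ t b → ((t , b) , i)) top bot ⟩
    ((tD , bD) , i)        ≡⟨ cong (_, i) (sym cols-D) ⟩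
    (cols D , i)           ∎
    where
    K-offset : ∀ d → suc (p + d) ≡ length (tops P) + suc d
    K-offset d = tops-offset P (suc d) (sym (+-suc p d))
    top-j-1 : at0 tE (suc (p + k)) ≡ true
    top-j-1 = trans (at0-++ (tops P) (suc k) (K-offset k)) (at0-++ K 0 K-end)
    top-j : at0 tE j ≡ false
    top-j = trans (at0-++ (tops P) (suc (suc k)) (tops-offset P _ (sym (trans (+-suc p (suc k)) (cong suc (+-suc p k))))))
                  (at0-++ K 1 (sym (trans (+-comm _ 1) (cong suc (length-replicate k)))))
    bot-j : at0 bE j ≡ false
    bot-j = at0-++-++ (bots P) (x ∷ kb) 1 (bots-offset P _ (arith p k))
      where
      arith : ∀ p k → suc (suc (p + k)) ≡ p + (suc k + 1)
      arith = solve-∀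
    run-black : ∀ d → d < suc k → at0 tE (suc p + d) ≡ true
    run-black d d≤k = trans (at0-++ (tops P) (suc d) (K-offset d))
                            (trans (cong (λ t → at0 t d) (replicate-++-∷ k true _)) (at0-replicate-++ (suc k) true d d≤k))
    scan : scanLb tE j ≡ i
    scan = begin
      scanLb tE j               ≡⟨ cong (scanLb tE) (sym (+-suc (suc p) k)) ⟩
      scanLb tE (suc p + suc k) ≡⟨ scanLb-skip tE (suc p) (suc k) run-black ⟩
      scanLb tE (suc p)         ≡⟨ if-false (at0-++ (tops P) 0 (tops-offset P 0 (sym (+-identityʳ p)))) ⟩
      i                         ∎
    top : insertAt i false (removeAt p tE) ≡ tD
    top = trans (cong (insertAt i false) (trans (removeAt-++ (tops P) 0 (tops-offset P 0 (sym (+-identityʳ p))))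
                                               (cong (tops P ++_) (replicate-++-∷ k true _))))
                (insertAt-++ (tops P) 1 false (tops-offset P 1 (+-comm 1 p)))
    bot : insertAt i false (removeAt (wpos n j ∸ 1) bE) ≡ bD
    bot = trans (cong (λ m → insertAt i false (removeAt (m ∸ 1) bE)) (wpos-< j<n))
                (trans (cong (insertAt i false) (removeAt-++-++ (bots P) (x ∷ kb) 1 (bots-offset P _ (arith p k))))
                       (insertAt-++ (bots P) 1 false (bots-offset P 1 (+-comm 1 p))))
      where
      arith : ∀ p k → suc (suc (p + k)) ≡ p + (suc k + 1)
      arith = solve-∀

  private
    Q : List Col
    Q = P ++ (false , x) ∷ run true kb

    E≡ : E ≡ Q ++ (true , y) ∷ (false , false) ∷ R
    E≡ = sym (++-assoc P ((false , x) ∷ run true kb) _)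
    M≡ : M ≡ Q ++ (false , y) ∷ R
    M≡ = sym (++-assoc P ((false , x) ∷ run true kb) _)

  path-D⇒M : ∀ {h h′} → Path h D h′ → Path h M h′
  path-D⇒M = peak⇒flat P x

  path-M⇒D : ∀ {h h′} → Path h M h′ → Path h D h′
  path-M⇒D = flat⇒peak P x

  path-E⇒M : ∀ {h h′} → Path h E h′ → Path h M h′
  path-E⇒M q = Path-resp (sym M≡) (peak⇒flat Q y (Path-resp E≡ q))

  path-M⇒E : ∀ {h h′} → Path h M h′ → Path h E h′
  path-M⇒E q = Path-resp (sym E≡) (flat⇒peak Q y (Path-resp M≡ q))

  labels-D : Path 0 M 0 → labelsFrom D (0 , false) ≡ labelsFrom M (0 , false)
  labels-D q = labels-peak P x _ false q

  labels-E : Path 0 M 0 → labelsFrom E (0 , false) ≡ labelsFrom M (0 , false)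
  labels-E q = trans (cong (λ cs → labelsFrom cs (0 , false)) E≡)
                     (trans (labels-peak Q y R false (Path-resp M≡ q)) (cong (λ cs → labelsFrom cs (0 , false)) (sym M≡)))

  exponents≡ : Path 0 M 0 → exponents n i D ≡ exponents n j E
  exponents≡ q = cong₂ (weighᵉ n) (trans (lamᵉ-inside n i (s≤s z≤n) i<n) (sym (lamᵉ-inside n j (s≤s z≤n) j<n)))
                                  (trans (labels-D q) (sym (labels-E q)))

  step : Path 0 D 0 → Step n D i
  step q = record
    { cs′ = E ; j = j ; Tbar≡ = forward ; Tbar⁻¹≡ = backward ; length≡ = length-E
    ; path = path-M⇒E (path-D⇒M q) ; j≤n = <⇒≤ j<n ; exponents≡ = exponents≡ (path-D⇒M q) }

  preimage : Path 0 E 0 → Preimage n E j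
  preimage q = record
    { cs = D ; i = i ; Tbar≡ = forward ; length≡ = length-D ; path = path-M⇒D (path-E⇒M q) ; i≤n = <⇒≤ i<n }

-- Case (a″) with j₂ = n: the peak is carried to the end and becomes (•,∘)

module CaseA″ₙ (P : List Col) (x : Bool) (kb : List Bool) where
  D E M : List Col
  D = P ++ (true , x) ∷ (false , false) ∷ run true kb
  E = P ++ (false , x) ∷ run true kb ++ [ (true , false) ]
  M = P ++ (false , x) ∷ run true kb

  p k i n : ℕ
  p = length P
  k = length kb
  i = suc p
  n = suc (suc (p + k))

  i<n : i < n
  i<n = s≤s (s≤s (m≤m+n p k))

  length-D : length D ≡ n
  length-D = trans (length-++ P) (trans (cong (λ m → p + suc (suc m)) (length-run true kb)) (arith p k))
    where
    arith : ∀ p k → p + suc (suc k) ≡ suc (suc (p + k))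
    arith = solve-∀

  length-E : length E ≡ n
  length-E = trans (length-shape P [ (false , x) ] true kb _) (arith p k)
    where
    arith : ∀ p k → p + (1 + (k + 1)) ≡ suc (suc (p + k))
    arith = solve-∀

  private
    K : List Bool
    K = replicate k true
    tD bD tE bE : List Bool
    tD = tops P ++ true ∷ false ∷ K ++ []
    bD = bots P ++ x ∷ false ∷ kb ++ []
    tE = tops P ++ false ∷ K ++ [ true ]
    bE = bots P ++ x ∷ kb ++ [ false ]

    cols-D : cols D ≡ (tD , bD)
    cols-D = cols-shape-end P ((true , x) ∷ (false , false) ∷ []) true kb
    cols-E : cols E ≡ (tE , bE)
    cols-E = cols-shape P [ (false , x) ] true kb _

    end-offset : suc (p + k) ≡ length (tops P) + (length (false ∷ K) + 0)
    end-offset = tops-offset P _ (trans (arith p k) (cong (λ m → p + (suc m + 0)) (sym (length-replicate k))))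
      where
      arith : ∀ p k → suc (p + k) ≡ p + (suc k + 0)
      arith = solve-∀
    end-offsetᵇ : suc (p + k) ≡ length (bots P) + (length (x ∷ kb) + 0)
    end-offsetᵇ = bots-offset P _ (arith p k)
      where
      arith : ∀ p k → suc (p + k) ≡ p + (suc k + 0)
      arith = solve-∀

  forward : Tbar n (cols D) i ≡ (cols E , n)
  forward = begin
    Tbar n (cols D) i      ≡⟨ cong (λ ω → Tbar n ω i) cols-D ⟩
    Tbar n (tD , bD) i     ≡⟨ Tbar-a″ n tD bD p (<⇒≡ᵇ≡false i<n) top-p top-i bot-i ⟩
    caseA'' n (tD , bD) i  ≡⟨ caseA″-eval n tD bD i scan ⟩
    ((insertAt (suc (p + k)) true (removeAt p tD) , insertAt (wpos n n ∸ 1) false (removeAt i bD)) , n)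
                           ≡⟨ cong₂ (λ t b → ((t , b) , n)) top bot ⟩
    ((tE , bE) , n)        ≡⟨ cong (_, n) (sym cols-E) ⟩
    (cols E , n)           ∎
    where
    top-p : at0 tD p ≡ true
    top-p = at0-++ (tops P) 0 (tops-offset P 0 (sym (+-identityʳ p)))
    top-i : at0 tD i ≡ false
    top-i = at0-++ (tops P) 1 (tops-offset P 1 (+-comm 1 p))
    bot-i : at0 bD i ≡ false
    bot-i = at0-++ (bots P) 1 (bots-offset P 1 (+-comm 1 p))
    run-black : ∀ d → d < k → at0 tD (suc i + d) ≡ true
    run-black d d<k = trans (at0-++ (tops P) (2 + d) (tops-offset P (2 + d) (arith p d))) (at0-replicate-++ k true d d<k)
      where
      arith : ∀ p d → suc (suc (p + d)) ≡ p + (2 + d)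
      arith = solve-∀
    range : n ∸ suc i ≡ k + 0
    range = trans (m+n∸m≡n p k) (sym (+-identityʳ k))
    scan : scanR tD (n ∸ suc i) (suc i) ≡ n
    scan = begin
      scanR tD (n ∸ suc i) (suc i) ≡⟨ cong (λ f → scanR tD f (suc i)) range ⟩
      scanR tD (k + 0) (suc i)     ≡⟨ scanR-skip tD k 0 (suc i) run-black ⟩
      n                            ∎
    top : insertAt (suc (p + k)) true (removeAt p tD) ≡ tE
    top = trans (cong (insertAt (suc (p + k)) true) (removeAt-++ (tops P) 0 (tops-offset P 0 (sym (+-identityʳ p)))))
                (insertAt-++-++ (tops P) (false ∷ K) 0 true end-offset)
    bot : insertAt (wpos n n ∸ 1) false (removeAt i bD) ≡ bE
    bot = trans (cong₂ (λ m → insertAt (m ∸ 1) false) (wpos-n n) (removeAt-++ (bots P) 1 (bots-offset P 1 (+-comm 1 p))))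
                (insertAt-++-++ (bots P) (x ∷ kb) 0 false end-offsetᵇ)

  backward : Tbar⁻¹ n (cols E) n ≡ (cols D , i)
  backward = begin
    Tbar⁻¹ n (cols E) n
      ≡⟨ cong (λ ω → Tbar⁻¹ n ω n) cols-E ⟩
    Tbar⁻¹ n (tE , bE) n
      ≡⟨ Tbar⁻¹-uncarryₙ (suc (p + k)) tE bE (at0-++-++ (tops P) (false ∷ K) 0 end-offset) ⟩
    uncarry n (tE , bE) n
      ≡⟨ uncarry-suc n tE bE n scan ⟩
    ((insertAt i false (removeAt p tE) , insertAt i false (removeAt (wpos n n ∸ 1) bE)) , i)
      ≡⟨ cong₂ (λ t b → ((t , b) , i)) top bot ⟩
    ((tD , bD) , i)
      ≡⟨ cong (_, i) (sym cols-D) ⟩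
    (cols D , i) ∎
    where
    run-black : ∀ d → d < suc k → at0 tE (suc p + d) ≡ true
    run-black d d≤k = trans (at0-++ (tops P) (suc d) (tops-offset P (suc d) (sym (+-suc p d))))
                            (trans (cong (λ t → at0 t d) (replicate-++-∷ k true [])) (at0-replicate-++ (suc k) true d d≤k))
    scan : scanLb tE n ≡ i
    scan = begin
      scanLb tE n               ≡⟨ cong (scanLb tE) (sym (+-suc (suc p) k)) ⟩
      scanLb tE (suc p + suc k) ≡⟨ scanLb-skip tE (suc p) (suc k) run-black ⟩
      scanLb tE (suc p)         ≡⟨ if-false (at0-++ (tops P) 0 (tops-offset P 0 (sym (+-identityʳ p)))) ⟩
      i                         ∎
    top : insertAt i false (removeAt p tE) ≡ tD
    top = trans (cong (insertAt i false) (trans (removeAt-++ (tops P) 0 (tops-offset P 0 (sym (+-identityʳ p))))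
                                               (cong (tops P ++_) (replicate-++-∷ k true []))))
                (insertAt-++ (tops P) 1 false (tops-offset P 1 (+-comm 1 p)))
    bot : insertAt i false (removeAt (wpos n n ∸ 1) bE) ≡ bD
    bot = trans (cong (λ m → insertAt i false (removeAt (m ∸ 1) bE)) (wpos-n n))
                (trans (cong (insertAt i false) (removeAt-++-++ (bots P) (x ∷ kb) 0 end-offsetᵇ))
                       (insertAt-++ (bots P) 1 false (bots-offset P 1 (+-comm 1 p))))

  private
    E≡ : E ≡ M ++ [ (true , false) ]
    E≡ = sym (++-assoc P ((false , x) ∷ run true kb) _)

  path-D⇒M : ∀ {h h′} → Path h D h′ → Path h M h′
  path-D⇒M = peak⇒flat P x

  path-M⇒D : ∀ {h h′} → Path h M h′ → Path h D h′
  path-M⇒D = flat⇒peak P x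

  path-E⇒M : ∀ {h h′} → Path h E h′ → Path h M h′
  path-E⇒M q = Path-resp (++-identityʳ M) (removeFlat M true (Path-resp E≡ q))

  path-M⇒E : ∀ {h h′} → Path h M h′ → Path h E h′
  path-M⇒E q = Path-resp (sym E≡) (insertFlat M true (Path-resp (sym (++-identityʳ M)) q))

  private
    L : ℕ × ℕ
    L = labelsFrom M (0 , false)

    labels-D : Path 0 M 0 → labelsFrom D (0 , false) ≡ L
    labels-D q = labels-peak P x _ false q

    labels-E : Path 0 M 0 → labelsFrom E (0 , false) ≡ (0 , 1) ⊕ L
    labels-E q = trans (cong (λ cs → labelsFrom cs (0 , false)) E≡) (labels-•∘-last M _ (after-height q false))

  exponents≡ : Path 0 M 0 → exponents n i D ≡ exponents n n E
  exponents≡ q = begin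
    weighᵉ n (lamᵉ n i) (labelsFrom D (0 , false))
      ≡⟨ cong₂ (weighᵉ n) (lamᵉ-inside n i (s≤s z≤n) i<n) (labels-D q) ⟩
    weighᵉ n αᵉ L
      ≡⟨ sym (weighᵉ-γ≡α n (proj₁ L) (proj₂ L) z<n) ⟩
    weighᵉ n γᵉ ((0 , 1) ⊕ L)
      ≡⟨ cong₂ (weighᵉ n) (sym (lamᵉ-n n (s≤s z≤n))) (sym (labels-E q)) ⟩
    weighᵉ n (lamᵉ n n) (labelsFrom E (0 , false)) ∎
    where
    z<n : suc (proj₂ L) ≤ n
    z<n = ≤-trans (m≤n+m _ _) (labels-bound E (labels-E q) length-E)

  step : Path 0 D 0 → Step n D i
  step q = record
    { cs′ = E ; j = n ; Tbar≡ = forward ; Tbar⁻¹≡ = backward ; length≡ = length-E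
    ; path = path-M⇒E (path-D⇒M q) ; j≤n = ≤-refl ; exponents≡ = exponents≡ (path-D⇒M q) }

  preimage : Path 0 E 0 → Preimage n E n
  preimage q = record
    { cs = D ; i = i ; Tbar≡ = forward ; length≡ = length-D ; path = path-M⇒D (path-E⇒M q) ; i≤n = <⇒≤ i<n }

-- Case (b) with j₂ < n: the first column (∘,•) becomes a peak right of the black tops

module CaseB (kb : List Bool) (y : Bool) (R : List Col) where
  D E M : List Col
  D = (false , true) ∷ run true kb ++ (false , y) ∷ R
  E = run true kb ++ (true , y) ∷ (false , false) ∷ R
  M = run true kb ++ (false , y) ∷ R

  k j n : ℕ
  k = length kb
  j = suc k
  n = j + suc (length R)

  j<n : j < n
  j<n = m<m+n j (s≤s z≤n)

  length-D : length D ≡ n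
  length-D = cong suc (length-shape [] [] true kb _)

  length-E : length E ≡ n
  length-E = trans (length-shape [] [] true kb _) (+-suc k _)

  private
    K : List Bool
    K = replicate k true
    tD bD tE bE : List Bool
    tD = false ∷ K ++ false ∷ tops R
    bD = true ∷ kb ++ y ∷ bots R
    tE = K ++ true ∷ false ∷ tops R
    bE = kb ++ y ∷ false ∷ bots R

    cols-D : cols D ≡ (tD , bD)
    cols-D = cols-shape [] [ (false , true) ] true kb _
    cols-E : cols E ≡ (tE , bE)
    cols-E = cols-shape [] [] true kb _

    after-K : ∀ d → k + d ≡ length K + d
    after-K d = cong (_+ d) (sym (length-replicate k))

  forward : Tbar n (cols D) 0 ≡ (cols E , j)
  forward = begin
    Tbar n (cols D) 0   ≡⟨ cong (λ ω → Tbar n ω 0) cols-D ⟩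
    Tbar n (tD , bD) 0  ≡⟨ Tbar-b n tD bD refl ⟩
    caseB n (tD , bD)   ≡⟨ caseB-eval n tD bD scan ⟩
    ((insertAt k true (K ++ false ∷ tops R) , insertAt (wpos n j ∸ 1) false (kb ++ y ∷ bots R)) , j)
                        ≡⟨ cong₂ (λ t b → ((t , b) , j)) top bot ⟩
    ((tE , bE) , j)     ≡⟨ cong (_, j) (sym cols-E) ⟩
    (cols E , j)        ∎
    where
    scan : scanR tD (n ∸ 1) 1 ≡ j
    scan = trans (scanR-skip tD k _ 1 (λ d d<k → at0-replicate-++ k true d d<k))
                 (if-false (at0-++ K 0 (trans (sym (+-identityʳ k)) (after-K 0))))
    top : insertAt k true (K ++ false ∷ tops R) ≡ tE
    top = insertAt-++ K 0 true (trans (sym (+-identityʳ k)) (after-K 0))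
    bot : insertAt (wpos n j ∸ 1) false (kb ++ y ∷ bots R) ≡ bE
    bot = trans (cong (λ m → insertAt (m ∸ 1) false (kb ++ y ∷ bots R)) (wpos-< j<n)) (insertAt-++ kb 1 false (+-comm 1 k))

  backward : Tbar⁻¹ n (cols E) j ≡ (cols D , 0)
  backward = begin
    Tbar⁻¹ n (cols E) j    ≡⟨ cong (λ ω → Tbar⁻¹ n ω j) cols-E ⟩
    Tbar⁻¹ n (tE , bE) j   ≡⟨ Tbar⁻¹-uncarry n tE bE k (<⇒≡ᵇ≡false j<n) top-k top-j bot-j ⟩
    uncarry n (tE , bE) j  ≡⟨ uncarry-0 n tE bE j scan ⟩
    ((false ∷ removeAt k tE , true ∷ removeAt (wpos n j ∸ 1) bE) , 0)
                           ≡⟨ cong₂ (λ t b → ((false ∷ t , true ∷ b) , 0)) top bot ⟩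
    ((tD , bD) , 0)        ≡⟨ cong (_, 0) (sym cols-D) ⟩
    (cols D , 0)           ∎
    where
    top-k : at0 tE k ≡ true
    top-k = at0-++ K 0 (trans (sym (+-identityʳ k)) (after-K 0))
    top-j : at0 tE j ≡ false
    top-j = at0-++ K 1 (trans (+-comm 1 k) (after-K 1))
    bot-j : at0 bE j ≡ false
    bot-j = at0-++ kb 1 (+-comm 1 k)
    run-black : ∀ d → d < j → at0 tE d ≡ true
    run-black d d≤k = trans (cong (λ t → at0 t d) (replicate-++-∷ k true _)) (at0-replicate-++ j true d d≤k)
    scan : scanLb tE j ≡ 0
    scan = scanLb-skip tE 0 j run-black
    top : removeAt k tE ≡ K ++ false ∷ tops R
    top = removeAt-++ K 0 (trans (sym (+-identityʳ k)) (after-K 0))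
    bot : removeAt (wpos n j ∸ 1) bE ≡ kb ++ y ∷ bots R
    bot = trans (cong (λ m → removeAt (m ∸ 1) bE) (wpos-< j<n)) (removeAt-++ kb 1 (+-comm 1 k))

  path-D⇒M : ∀ {h h′} → Path h D h′ → Path h M h′
  path-D⇒M (flat∘• q) = q

  path-E⇒M : ∀ {h h′} → Path h E h′ → Path h M h′
  path-E⇒M = peak⇒flat (run true kb) y

  path-M⇒E : ∀ {h h′} → Path h M h′ → Path h E h′
  path-M⇒E = flat⇒peak (run true kb) y

  private
    L : ℕ × ℕ
    L = labelsFrom M (0 , false)

    labels-E : Path 0 M 0 → labelsFrom E (0 , false) ≡ L
    labels-E q = labels-peak (run true kb) y R false q

  exponents≡ : Path 0 M 0 → exponents n 0 D ≡ exponents n j E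
  exponents≡ q = begin
    weighᵉ n βᵉ ((1 , 0) ⊕ L)
      ≡⟨ sym (weighᵉ-α≡β n (proj₁ L) (proj₂ L) y<n) ⟩
    weighᵉ n αᵉ L
      ≡⟨ cong₂ (weighᵉ n) (sym (lamᵉ-inside n j (s≤s z≤n) j<n)) (sym (labels-E q)) ⟩
    weighᵉ n (lamᵉ n j) (labelsFrom E (0 , false)) ∎
    where
    y<n : suc (proj₁ L) ≤ n
    y<n = ≤-trans (m≤m+n _ _) (labels-bound D refl length-D)

  step : Path 0 D 0 → Step n D 0
  step q = record
    { cs′ = E ; j = j ; Tbar≡ = forward ; Tbar⁻¹≡ = backward ; length≡ = length-E
    ; path = path-M⇒E (path-D⇒M q) ; j≤n = <⇒≤ j<n ; exponents≡ = exponents≡ (path-D⇒M q) }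

  preimage : Path 0 E 0 → Preimage n E j
  preimage q = record
    { cs = D ; i = 0 ; Tbar≡ = forward ; length≡ = length-D ; path = flat∘• (path-E⇒M q) ; i≤n = z≤n }

-- Case (b) with j₂ = n: the first column (∘,•) becomes the last column (•,∘)

module CaseBₙ (kb : List Bool) where
  D E M : List Col
  D = (false , true) ∷ run true kb
  E = run true kb ++ [ (true , false) ]
  M = run true kb

  k n : ℕ
  k = length kb
  n = suc k

  length-D : length D ≡ n
  length-D = cong suc (length-run true kb)

  length-E : length E ≡ n
  length-E = trans (length-shape [] [] true kb _) (+-comm k 1)

  private
    K : List Bool
    K = replicate k true
    tD bD tE bE : List Bool
    tD = false ∷ K ++ []
    bD = true ∷ kb ++ []
    tE = K ++ [ true ]
    bE = kb ++ [ false ]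

    cols-D : cols D ≡ (tD , bD)
    cols-D = cols-shape-end [] [ (false , true) ] true kb
    cols-E : cols E ≡ (tE , bE)
    cols-E = cols-shape [] [] true kb _

    end-offset : k ≡ length K + 0
    end-offset = sym (trans (+-identityʳ _) (length-replicate k))
    end-offsetᵇ : k ≡ length kb + 0
    end-offsetᵇ = sym (+-identityʳ k)

  forward : Tbar n (cols D) 0 ≡ (cols E , n)
  forward = begin
    Tbar n (cols D) 0   ≡⟨ cong (λ ω → Tbar n ω 0) cols-D ⟩
    Tbar n (tD , bD) 0  ≡⟨ Tbar-b n tD bD refl ⟩
    caseB n (tD , bD)   ≡⟨ caseB-eval n tD bD scan ⟩
    ((insertAt k true (K ++ []) , insertAt (wpos n n ∸ 1) false (kb ++ [])) , n)
                        ≡⟨ cong₂ (λ t b → ((t , b) , n)) top bot ⟩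
    ((tE , bE) , n)     ≡⟨ cong (_, n) (sym cols-E) ⟩
    (cols E , n)        ∎
    where
    scan : scanR tD k 1 ≡ n
    scan = trans (cong (λ f → scanR tD f 1) (sym (+-identityʳ k)))
                 (scanR-skip tD k 0 1 (λ d d<k → at0-replicate-++ k true d d<k))
    top : insertAt k true (K ++ []) ≡ tE
    top = insertAt-++ K 0 true end-offset
    bot : insertAt (wpos n n ∸ 1) false (kb ++ []) ≡ bE
    bot = trans (cong (λ m → insertAt (m ∸ 1) false (kb ++ [])) (wpos-n n)) (insertAt-++ kb 0 false end-offsetᵇ)

  backward : Tbar⁻¹ n (cols E) n ≡ (cols D , 0)
  backward = begin
    Tbar⁻¹ n (cols E) n    ≡⟨ cong (λ ω → Tbar⁻¹ n ω n) cols-E ⟩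
    Tbar⁻¹ n (tE , bE) n   ≡⟨ Tbar⁻¹-uncarryₙ k tE bE (at0-++ K 0 end-offset) ⟩
    uncarry n (tE , bE) n  ≡⟨ uncarry-0 n tE bE n scan ⟩
    ((false ∷ removeAt k tE , true ∷ removeAt (wpos n n ∸ 1) bE) , 0)
                           ≡⟨ cong₂ (λ t b → ((false ∷ t , true ∷ b) , 0)) top bot ⟩
    ((tD , bD) , 0)        ≡⟨ cong (_, 0) (sym cols-D) ⟩
    (cols D , 0)           ∎
    where
    run-black : ∀ d → d < n → at0 tE d ≡ true
    run-black d d≤k = trans (cong (λ t → at0 t d) (replicate-++-∷ k true [])) (at0-replicate-++ n true d d≤k)
    scan : scanLb tE n ≡ 0
    scan = scanLb-skip tE 0 n run-black
    top : removeAt k tE ≡ K ++ []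
    top = removeAt-++ K 0 end-offset
    bot : removeAt (wpos n n ∸ 1) bE ≡ kb ++ []
    bot = trans (cong (λ m → removeAt (m ∸ 1) bE) (wpos-n n)) (removeAt-++ kb 0 end-offsetᵇ)

  path-E⇒M : ∀ {h h′} → Path h E h′ → Path h M h′
  path-E⇒M q = Path-resp (++-identityʳ M) (removeFlat M true q)

  path-M⇒E : ∀ {h h′} → Path h M h′ → Path h E h′
  path-M⇒E q = insertFlat M true (Path-resp (sym (++-identityʳ M)) q)

  private
    L : ℕ × ℕ
    L = labelsFrom M (0 , false)

    labels-E : Path 0 M 0 → labelsFrom E (0 , false) ≡ (0 , 1) ⊕ L
    labels-E q = labels-•∘-last M _ (after-height q false)

  exponents≡ : Path 0 M 0 → exponents n 0 D ≡ exponents n n E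
  exponents≡ q = begin
    weighᵉ n βᵉ ((1 , 0) ⊕ L)
      ≡⟨ sym (weighᵉ-γ≡β n (proj₁ L) (proj₂ L) y<n z<n) ⟩
    weighᵉ n γᵉ ((0 , 1) ⊕ L)
      ≡⟨ cong₂ (weighᵉ n) (sym (lamᵉ-n n (s≤s z≤n))) (sym (labels-E q)) ⟩
    weighᵉ n (lamᵉ n n) (labelsFrom E (0 , false)) ∎
    where
    y<n : suc (proj₁ L) ≤ n
    y<n = ≤-trans (m≤m+n _ _) (labels-bound D refl length-D)
    z<n : suc (proj₂ L) ≤ n
    z<n = ≤-trans (m≤n+m _ _) (labels-bound E (labels-E q) length-E)

  step : Path 0 D 0 → Step n D 0
  step (flat∘• q) = record
    { cs′ = E ; j = n ; Tbar≡ = forward ; Tbar⁻¹≡ = backward ; length≡ = length-E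
    ; path = path-M⇒E q ; j≤n = ≤-refl ; exponents≡ = exponents≡ q }

  preimage : Path 0 E 0 → Preimage n E n
  preimage q = record
    { cs = D ; i = 0 ; Tbar≡ = forward ; length≡ = length-D ; path = flat∘• (path-E⇒M q) ; i≤n = z≤n }

-- Classification of the pairs (ω , i)

Step-via : ∀ {n m cs D i i′} → cs ≡ D → length cs ≡ n → length D ≡ m → i′ ≡ i →
           (Path 0 D 0 → Step m D i′) → Path 0 cs 0 → Step n cs i
Step-via refl refl refl refl step q = step q

Preimage-via : ∀ {n m cs E j j′} → cs ≡ E → length cs ≡ n → length E ≡ m → j′ ≡ j →
               (Path 0 E 0 → Preimage m E j′) → Path 0 cs 0 → Preimage n cs j
Preimage-via refl refl refl refl preimage q = preimage q

≡-length : ∀ {cs D : List Col} {n m} → cs ≡ D → length cs ≡ n → length D ≡ m → m ≡ n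
≡-length refl refl refl = refl

inactive-last : ∀ L b n → length (L ++ [ (false , b) ]) ≡ n → active n (tops (L ++ [ (false , b) ])) n ≡ false
inactive-last L b n refl =
  subst (λ m → active m (tops (L ++ [ (false , b) ])) m ≡ false) (sym (length-snoc L _))
        (inactive-n (length L) (tops (L ++ [ (false , b) ])) (at0-tops-at L (false , b) [] refl))

inactive-white-at : ∀ n L b c₂ R {i} → length L ≡ i → suc i < n →
                    active n (tops (L ++ (false , b) ∷ c₂ ∷ R)) (suc i) ≡ false
inactive-white-at n L b c₂ R l i<n =
  inactive-white n (tops (L ++ (false , b) ∷ c₂ ∷ R)) _ i<n (at0-tops-at L (false , b) (c₂ ∷ R) l)

inactive-black-black-at : ∀ n L x b R {i} → length L ≡ i → suc i < n →
                          active n (tops (L ++ (true , x) ∷ (true , b) ∷ R)) (suc i) ≡ false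
inactive-black-black-at n L x b R l i<n =
  inactive-black-black n (tops (L ++ (true , x) ∷ (true , b) ∷ R)) _ i<n (at0-tops-after L (true , x) (true , b) R l)

fixed-step : ∀ n cs i → length cs ≡ n → Path 0 cs 0 → i ≤ n → active n (tops cs) i ≡ false → Step n cs i
fixed-step n cs i len q i≤n inactive = record
  { cs′ = cs ; j = i ; Tbar≡ = Tbar-inactive n (tops cs) (bots cs) i inactive
  ; Tbar⁻¹≡ = Tbar⁻¹-inactive n (tops cs) (bots cs) i inactive
  ; length≡ = len ; path = q ; j≤n = i≤n ; exponents≡ = refl }

fixed-preimage : ∀ n cs j → length cs ≡ n → Path 0 cs 0 → j ≤ n → active n (tops cs) j ≡ false → Preimage n cs j
fixed-preimage n cs j len q j≤n inactive = record
  { cs = cs ; i = j ; Tbar≡ = Tbar-inactive n (tops cs) (bots cs) j inactive ; length≡ = len ; path = q ; i≤n = j≤n }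

step-first : ∀ n cs → length cs ≡ n → 0 < n → Path 0 cs 0 → Step n cs 0
step-first n [] refl () q
step-first n ((true , b) ∷ cs) len _ q = fixed-step n _ 0 len q z≤n (inactive-0 n (true ∷ tops cs) refl)
step-first n ((false , true) ∷ cs) len _ q with leadingRun true cs
... | kb , .[] , refl , empty =
  Step-via (cong ((false , true) ∷_) (++-identityʳ _)) len (CaseBₙ.length-D kb) refl (CaseBₙ.step kb) q
... | kb , .((false , y) ∷ R) , refl , head y R =
  Step-via refl len (CaseB.length-D kb y R) refl (CaseB.step kb y R) q

step-last : ∀ n cs → length cs ≡ n → 0 < n → Path 0 cs 0 → Step n cs n
step-last n cs len 0<n q with split-last cs (subst (0 <_) (sym len) 0<n)
... | L , (true , true) , refl = ⊥-elim (¬Path-up-last L q)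
... | L , (false , b) , refl = fixed-step n _ n len q ≤-refl (inactive-last L b n len)
... | L , (true , false) , refl with trailingRun false L
... | P , ws , refl , stop =
  Step-via shape len (CaseC.length-D P ws) (≡-length shape len (CaseC.length-D P ws)) (CaseC.step P ws stop) q
  where
  shape : (P ++ run false ws) ++ [ (true , false) ] ≡ CaseC.D P ws
  shape = ++-assoc P (run false ws) _

step-inside : ∀ n cs i → length cs ≡ n → suc i < n → Path 0 cs 0 → Step n cs (suc i)
step-inside n cs i len i<n q with split-at cs i (subst (suc i <_) (sym len) i<n)
... | L , (false , b) , c₂ , R , refl , l =
  fixed-step n _ (suc i) len q (<⇒≤ i<n) (inactive-white-at n L b c₂ R l i<n)
... | L , (true , x) , (true , b) , R , refl , l =
  fixed-step n _ (suc i) len q (<⇒≤ i<n) (inactive-black-black-at n L x b R l i<n)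
... | L , (true , x) , (false , true) , R , refl , l with trailingRun false L
... | P , ws , refl , stop =
  Step-via (++-assoc P (run false ws) _) len (CaseA′.length-D P ws x R) i≡ (CaseA′.step P ws x R stop) q
  where
  i≡ : CaseA′.i P ws x R ≡ suc i
  i≡ = cong suc (trans (sym (length-++-run P false ws)) l)
step-inside n cs i len i<n q | L , (true , x) , (false , false) , R , refl , l with leadingRun true R
... | kb , .[] , refl , empty =
  Step-via (cong (λ cs → L ++ (true , x) ∷ (false , false) ∷ cs) (++-identityʳ _)) len (CaseA″ₙ.length-D L x kb)
           (cong suc l) (CaseA″ₙ.step L x kb) q
... | kb , .((false , y) ∷ R′) , refl , head y R′ =
  Step-via refl len (CaseA″.length-D L x kb y R′) (cong suc l) (CaseA″.step L x kb y R′) q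

step : ∀ n cs i → length cs ≡ n → 0 < n → Path 0 cs 0 → i ≤ n → Step n cs i
step n cs zero    len 0<n q _   = step-first n cs len 0<n q
step n cs (suc i) len 0<n q i≤n with m≤n⇒m<n∨m≡n i≤n
... | inj₁ i<n  = step-inside n cs i len i<n q
... | inj₂ refl = step-last (suc i) cs len 0<n q

preimage-first : ∀ n cs → length cs ≡ n → 0 < n → Path 0 cs 0 → Preimage n cs 0
preimage-first n [] refl () q
preimage-first n ((true , b) ∷ cs) len _ q = fixed-preimage n _ 0 len q z≤n (inactive-0 n (true ∷ tops cs) refl)
preimage-first n ((false , true) ∷ cs) len _ q with leadingRun false cs
... | ws , .[] , refl , empty =
  Preimage-via (cong ((false , true) ∷_) (++-identityʳ _)) len (CaseC.length-E [] ws) refl (CaseC.preimage [] ws empty) q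
... | ws , .((true , x) ∷ R) , refl , head x R =
  Preimage-via refl len (CaseA′.length-E [] ws x R) refl (CaseA′.preimage [] ws x R empty) q

preimage-last : ∀ n cs → length cs ≡ n → 0 < n → Path 0 cs 0 → Preimage n cs n
preimage-last n cs len 0<n q with split-last cs (subst (0 <_) (sym len) 0<n)
... | L , (true , true) , refl = ⊥-elim (¬Path-up-last L q)
... | L , (false , b) , refl = fixed-preimage n _ n len q ≤-refl (inactive-last L b n len)
... | L , (true , false) , refl with trailingRun true L
... | .[] , kb , refl , empty =
  Preimage-via refl len (CaseBₙ.length-E kb) (trans (sym (CaseBₙ.length-E kb)) len) (CaseBₙ.preimage kb) q
... | .(P ++ [ (false , x) ]) , kb , refl , last P x =
  Preimage-via shape len (CaseA″ₙ.length-E P x kb) (≡-length shape len (CaseA″ₙ.length-E P x kb))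
    (CaseA″ₙ.preimage P x kb) q
  where
  shape : ((P ++ [ (false , x) ]) ++ run true kb) ++ [ (true , false) ] ≡ CaseA″ₙ.E P x kb
  shape = ++-snoc-assoc P (run true kb) _ _

preimage-inside : ∀ n cs j → length cs ≡ n → suc j < n → Path 0 cs 0 → Preimage n cs (suc j)
preimage-inside n cs j len j<n q with split-at cs j (subst (suc j <_) (sym len) j<n)
... | L , (false , b) , c₂ , R , refl , l =
  fixed-preimage n _ (suc j) len q (<⇒≤ j<n) (inactive-white-at n L b c₂ R l j<n)
... | L , (true , y) , (true , b) , R , refl , l =
  fixed-preimage n _ (suc j) len q (<⇒≤ j<n) (inactive-black-black-at n L y b R l j<n)
... | L , (true , y) , (false , true) , R , refl , l with leadingRun false R
... | ws , .[] , refl , empty =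
  Preimage-via eq len (CaseC.length-E P ws) (trans (length-snoc L _) (cong suc l)) (CaseC.preimage P ws (last L y)) q
  where
  P : List Col
  P = L ++ [ (true , y) ]
  eq : L ++ (true , y) ∷ (false , true) ∷ run false ws ++ [] ≡ P ++ (false , true) ∷ run false ws
  eq = trans (cong (λ cs → L ++ (true , y) ∷ (false , true) ∷ cs) (++-identityʳ _)) (sym (++-assoc L _ _))
... | ws , .((true , x) ∷ R₁) , refl , head x R₁ =
  Preimage-via (sym (++-assoc L _ _)) len (CaseA′.length-E P ws x R₁) (trans (length-snoc L _) (cong suc l))
    (CaseA′.preimage P ws x R₁ (last L y)) q
  where
  P : List Col
  P = L ++ [ (true , y) ]
preimage-inside n cs j len j<n q | L , (true , y) , (false , false) , R , refl , l with trailingRun true L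
... | .[] , kb , refl , empty =
  Preimage-via refl len (CaseB.length-E kb y R) (cong suc (trans (sym (length-run true kb)) l)) (CaseB.preimage kb y R) q
... | .(P ++ [ (false , x) ]) , kb , refl , last P x =
  Preimage-via (++-snoc-assoc P (run true kb) _ _) len (CaseA″.length-E P x kb y R) (cong suc j≡)
    (CaseA″.preimage P x kb y R) q
  where
  j≡ : suc (length P + length kb) ≡ j
  j≡ = trans (cong (_+ length kb) (sym (length-snoc P _))) (trans (sym (length-++-run (P ++ [ (false , x) ]) true kb)) l)

preimage : ∀ n cs j → length cs ≡ n → 0 < n → Path 0 cs 0 → j ≤ n → Preimage n cs j
preimage n cs zero    len 0<n q _   = preimage-first n cs len 0<n q
preimage n cs (suc j) len 0<n q j≤n with m≤n⇒m<n∨m≡n j≤n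
... | inj₁ j<n  = preimage-inside n cs j len j<n q
... | inj₂ refl = preimage-last (suc j) cs len 0<n q

module Weighing {c ℓ} (R : CommutativeSemiring c ℓ) (α β γ : CommutativeSemiring.Carrier R) where
  open CommutativeSemiring R using (Carrier; _≈_; _*_; *-commutativeMonoid)
    renaming (refl to ≈-refl; sym to ≈-sym; trans to ≈-trans; reflexive to ≈-reflexive)
  open Weights R using (pow; q; lam)
  open CommutativeMonoidSolver *-commutativeMonoid using (solve; _⊜_) renaming (_⊕_ to _·_)

  monomial : Exponents → Carrier
  monomial (a , b , c) = pow α a * pow β b * pow γ c

  lam*monomial : ∀ n i y z →
    lam n α β γ i * monomial (y + z , n ∸ y , n ∸ z) ≈ monomial (weighᵉ n (lamᵉ n i) (y , z))
  lam*monomial n i y z with i ≡ᵇ 0 | i ≡ᵇ n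
  ... | true  | _     = solve 4 (λ x a b c → x · ((a · b) · c) ⊜ (a · (x · b)) · c) ≈-refl β _ _ _
  ... | false | true  = solve 4 (λ x a b c → x · ((a · b) · c) ⊜ (a · b) · (x · c)) ≈-refl γ _ _ _
  ... | false | false = solve 4 (λ x a b c → x · ((a · b) · c) ⊜ ((x · a) · b) · c) ≈-refl α _ _ _

  lam*q≈monomial : ∀ n i cs → lam n α β γ i * q n α β γ (cols cs) ≈ monomial (exponents n i cs)
  lam*q≈monomial n i cs =
    ≈-trans (≈-reflexive (cong (λ l → lam n α β γ i * monomial (proj₁ l + proj₂ l , n ∸ proj₁ l , n ∸ proj₂ l))
                           (cong (λ cs → labels cs 0 false) (zip-tops-bots cs))))
          (lam*monomial n i (proj₁ (labels cs 0 false)) (proj₂ (labels cs 0 false)))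

  exponents≡⇒≈ : ∀ n i j cs cs′ → exponents n i cs ≡ exponents n j cs′ →
                 lam n α β γ i * q n α β γ (cols cs) ≈ lam n α β γ j * q n α β γ (cols cs′)
  exponents≡⇒≈ n i j cs cs′ e =
    ≈-trans (lam*q≈monomial n i cs) (≈-trans (≈-reflexive (cong monomial e)) (≈-sym (lam*q≈monomial n j cs′)))

complete-step : ∀ n ω i → 0 < n → Complete n ω → i ≤ n → Σ[ cs ∈ List Col ] ω ≡ cols cs × Step n cs i
complete-step n (t , b) i 0<n complete i≤n with Complete⇒Path n t b complete
... | cs , ω≡ , len , q = cs , ω≡ , step n cs i len 0<n q i≤n

Tbar-closed : ∀ n → 0 < n → ∀ ω i → Complete n ω → i ≤ n →
              Complete n (proj₁ (Tbar n ω i)) × proj₂ (Tbar n ω i) ≤ n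
Tbar-closed n 0<n ω i complete i≤n with complete-step n ω i 0<n complete i≤n
... | cs , refl , s =
  subst (λ r → Complete n (proj₁ r) × proj₂ r ≤ n) (sym Tbar≡) (Path⇒Complete n cs′ length≡ path , j≤n)
  where open Step s

Tbar⁻¹-Tbar : ∀ n → 0 < n → ∀ ω i → Complete n ω → i ≤ n →
              Tbar⁻¹ n (proj₁ (Tbar n ω i)) (proj₂ (Tbar n ω i)) ≡ (ω , i)
Tbar⁻¹-Tbar n 0<n ω i complete i≤n with complete-step n ω i 0<n complete i≤n
... | cs , refl , s = trans (cong (λ r → Tbar⁻¹ n (proj₁ r) (proj₂ r)) Tbar≡) Tbar⁻¹≡
  where open Step s

Tbar-injective : ∀ n → 0 < n → ∀ ω ω′ i i′ → Complete n ω → i ≤ n → Complete n ω′ → i′ ≤ n →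
                 Tbar n ω i ≡ Tbar n ω′ i′ → (ω ≡ ω′) × (i ≡ i′)
Tbar-injective n 0<n ω ω′ i i′ complete i≤n complete′ i′≤n e = cong proj₁ ωi≡ , cong proj₂ ωi≡
  where
  ωi≡ : (ω , i) ≡ (ω′ , i′)
  ωi≡ = trans (sym (Tbar⁻¹-Tbar n 0<n ω i complete i≤n))
              (trans (cong (λ r → Tbar⁻¹ n (proj₁ r) (proj₂ r)) e) (Tbar⁻¹-Tbar n 0<n ω′ i′ complete′ i′≤n))

Tbar-surjective : ∀ n → 0 < n → ∀ ω′ j → Complete n ω′ → j ≤ n →
                  Σ Config (λ ω → Σ ℕ (λ i → Complete n ω × i ≤ n × Tbar n ω i ≡ (ω′ , j)))
Tbar-surjective n 0<n (t , b) j complete j≤n with Complete⇒Path n t b complete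
... | cs′ , refl , len , q = cols cs , i , Path⇒Complete n cs length≡ path , i≤n , Tbar≡
  where open Preimage (preimage n cs′ j len 0<n q j≤n)

Tbar-balanced : ∀ {c ℓ} (R : CommutativeSemiring c ℓ) n → 0 < n → (α β γ : CommutativeSemiring.Carrier R) →
                ∀ ω i → Complete n ω → i ≤ n →
                CommutativeSemiring._≈_ R
                  (CommutativeSemiring._*_ R (Weights.lam R n α β γ i) (Weights.q R n α β γ ω))
                  (CommutativeSemiring._*_ R (Weights.lam R n α β γ (proj₂ (Tbar n ω i)))
                                             (Weights.q R n α β γ (proj₁ (Tbar n ω i))))
Tbar-balanced R n 0<n α β γ ω i complete i≤n with complete-step n ω i 0<n complete i≤n
... | cs , refl , s rewrite Step.Tbar≡ s = exponents≡⇒≈ n i j cs cs′ exponents≡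
  where
  open Step s
  open Weighing R α β γ

lemma3 : ∀ {c ℓ} (R : CommutativeSemiring c ℓ) (n : ℕ) → 1 ≤ n →
         (α β γ : CommutativeSemiring.Carrier R) →
         -- T̄ maps Ω⁰ₙ × {0..n} into itself
         ((ω : Config) (i : ℕ) → Complete n ω → i ≤ n →
            Complete n (proj₁ (Tbar n ω i)) × proj₂ (Tbar n ω i) ≤ n)
         -- T̄ is injective on Ω⁰ₙ × {0..n}
         × ((ω ω′ : Config) (i i′ : ℕ) → Complete n ω → i ≤ n →
            Complete n ω′ → i′ ≤ n → Tbar n ω i ≡ Tbar n ω′ i′ →
            (ω ≡ ω′) × (i ≡ i′))
         -- T̄ is surjective onto Ω⁰ₙ × {0..n}
         × ((ω′ : Config) (j : ℕ) → Complete n ω′ → j ≤ n →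
            Σ Config (λ ω → Σ ℕ (λ i →
              Complete n ω × i ≤ n × Tbar n ω i ≡ (ω′ , j))))
         -- λ(i) q(ω) = λ(j) q(ω′) where (ω′ , j) = T̄(ω , i)
         × ((ω : Config) (i : ℕ) → Complete n ω → i ≤ n →
            CommutativeSemiring._≈_ R
              (CommutativeSemiring._*_ R (Weights.lam R n α β γ i) (Weights.q R n α β γ ω))
              (CommutativeSemiring._*_ R (Weights.lam R n α β γ (proj₂ (Tbar n ω i)))
                                         (Weights.q R n α β γ (proj₁ (Tbar n ω i)))))
lemma3 R n 1≤n α β γ =
  Tbar-closed n 1≤n , Tbar-injective n 1≤n , Tbar-surjective n 1≤n , Tbar-balanced R n 1≤n α β γ
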